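{- Let $k\geq 3$ be an integer and let $G=(\langle a\rangle\rtimes\langle b\rangle)\times\langle c\rangle\times\langle d\rangle$, where $|a|=k$, $|b|=|c|=|d|=2$ and $bab=a^{ -1}$. Let $A=\langle a\rangle$, $$S=b(A\setminus\{a^{ -1}\})\cup c(A\cup\{b\})\cup\{db,\,dcba^{ -1}\},$$ and $\Gamma=\mathrm{Cay}(G,S)$. Let $A_1=\langle a^2\rangle$, $L=A_1\rtimes\langle cb\rangle$ (a normal subgroup of $G$), and $U=\langle L,ca,da\rangle$. Then $\mathrm{WL}(\Gamma)=\mathbb{Z}G$ if $k$ is odd, and if $k$ is even then $\mathrm{WL}(\Gamma)=\mathbb{Z}U\wr_{U/L}\mathbb{Z}(G/L)$, i.e. $\mathrm{WL}(\Gamma)$ is the $S$-ring over $G$ whose basic sets are the singletons $\{g\}$, $g\in U$, together with the cosets $Lg$, $g\in G\setminus U$.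
   Context: The Cayley graph $\mathrm{Cay}(G,S)$ has vertex set $G$ and arcs $(g,sg)$, $s\in S$, $g\in G$. For $Y\subseteq G$ write $\underline{Y}=\sum_{y\in Y}y\in\mathbb{Z}G$. A subring $\mathcal{A}\subseteq\mathbb{Z}G$ is an $S$-ring over $G$ if there is a partition $\mathcal{S}(\mathcal{A})$ of $G$ (the basic sets) with $\{e\}\in\mathcal{S}(\mathcal{A})$, $Y\in\mathcal{S}(\mathcal{A})\Rightarrow Y^{ -1}\in\mathcal{S}(\mathcal{A})$, and $\mathcal{A}=\mathrm{Span}_{\mathbb{Z}}\{\underline{Y}:Y\in\mathcal{S}(\mathcal{A})\}$. The WL-closure $\mathrm{WL}(\Gamma)$ of $\Gamma=\mathrm{Cay}(G,S)$ is the smallest $S$-ring $\mathcal{A}$ over $G$ such that $S$ is a union of basic sets of $\mathcal{A}$. $\mathbb{Z}G$ denotes the $S$-ring whose basic sets are all singletons. For $\mathcal{A}$-subgroups $L\trianglelefteq G$, $L\le U\le G$, the generalized wreath product $\mathcal{A}_U\wr_{U/L}\mathcal{A}_{G/L}$ means $\mathcal{A}$ is such that $Lx=xL=X$-stabilizes every basic set $X$ outside $U$ (i.e. $L\le\{g: Xg=gX=X\}$ for each basic set $X\not\subseteq U$); here $\mathbb{Z}U\wr_{U/L}\mathbb{Z}(G/L)$ is the $S$-ring described explicitly in the claim. -}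

module Defs where

open import Data.Nat using (ℕ; zero; suc; _+_; _∸_; NonZero)
open import Data.Nat.DivMod using (_mod_)
open import Data.Fin using (Fin; toℕ)
open import Data.Bool using (Bool; true; false; _xor_; if_then_else_)
open import Data.Product using (Σ; _×_; _,_; proj₁; proj₂)
open import Data.Sum using (_⊎_)
open import Relation.Binary.PropositionalEquality using (_≡_; _≢_)
open import Relation.Nullary using (¬_)
open import Function.Bundles using (_↔_)

-- The group G = (⟨a⟩ ⋊ ⟨b⟩) × ⟨c⟩ × ⟨d⟩ with |a| = k, |b|=|c|=|d|=2, bab = a⁻¹.
-- The element ⟨ i , j , l , m ⟩ stands for the normal form a^i b^j c^l d^m.
module _ (k : ℕ) .{{_ : NonZero k}} where

  record G : Set where
    constructor ⟨_,_,_,_⟩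
    field
      ea : Fin k
      eb ec ed : Bool

  infixl 7 _·_

  -- (a^i b^j c^l d^m)(a^i' b^j' c^l' d^m') = a^(i ± i') b^(j+j') c^(l+l') d^(m+m')
  _·_ : G → G → G
  ⟨ i , j , l , m ⟩ · ⟨ i' , j' , l' , m' ⟩ =
    ⟨ (toℕ i + (if j then k ∸ toℕ i' else toℕ i')) mod k , j xor j' , l xor l' , m xor m' ⟩

  e : G
  e = ⟨ 0 mod k , false , false , false ⟩

  inv : G → G
  inv ⟨ i , j , l , m ⟩ = ⟨ (if j then toℕ i else k ∸ toℕ i) mod k , j , l , m ⟩

  a b c d : G
  a = ⟨ 1 mod k , false , false , false ⟩
  b = ⟨ 0 mod k , true , false , false ⟩
  c = ⟨ 0 mod k , false , true , false ⟩
  d = ⟨ 0 mod k , false , false , true ⟩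

  data Gen (P : G → Set) : G → Set where
    gen-e   : Gen P e
    gen-in  : ∀ {x} → P x → Gen P x
    gen-mul : ∀ {x y} → Gen P x → Gen P y → Gen P (x · y)
    gen-inv : ∀ {x} → Gen P x → Gen P (inv x)

  A : G → Set
  A = Gen (λ x → x ≡ a)

  S : G → Set
  S x =   (Σ G λ t → A t × t ≢ inv a × x ≡ b · t)
        ⊎ (Σ G λ t → A t × x ≡ c · t)
        ⊎ x ≡ c · b
        ⊎ x ≡ d · b
        ⊎ x ≡ d · c · b · inv a

  A₁ : G → Set
  A₁ = Gen (λ x → x ≡ a · a)

  L : G → Set
  L x = Σ G λ y → Σ G λ z → A₁ y × Gen (λ w → w ≡ c · b) z × x ≡ y · z

  U : G → Set
  U = Gen (λ x → L x ⊎ x ≡ c · a ⊎ x ≡ d · a)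

  -- A partition of G is given by a colouring col : G → ℕ; the basic sets are the
  -- (nonempty) fibres of col.  X = class of x₀, Y = class of y₀.
  -- Structure constant: the number of pairs (x , y) ∈ X × Y with x y = z.
  Pairs : (G → ℕ) → G → G → G → Set
  Pairs col x₀ y₀ z =
    Σ (G × G) λ p → col (proj₁ p) ≡ col x₀ × col (proj₂ p) ≡ col y₀ × proj₁ p · proj₂ p ≡ z

  -- The partition defines an S-ring: {e} is basic, X⁻¹ is basic for basic X, and
  -- the ℤ-span of the basic sets is closed under multiplication, i.e. in
  -- X̲ Y̲ = Σ_z c_z z the coefficient c_z is constant on each basic set.
  record IsSRing (col : G → ℕ) : Set where
    field
      e-basic   : ∀ x → col x ≡ col e → x ≡ e
      inv-basic : ∀ x y → col x ≡ col y → col (inv x) ≡ col (inv y)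
      mult      : ∀ x₀ y₀ z z' → col z ≡ col z' → Pairs col x₀ y₀ z ↔ Pairs col x₀ y₀ z'

  SUnion : (G → ℕ) → Set
  SUnion col = ∀ x y → col x ≡ col y → S x → S y

  -- WL(Cay(G,S)): the smallest S-ring such that S is a union of basic sets.
  -- (𝒜 ⊆ 𝒜' iff every basic set of 𝒜' lies in a basic set of 𝒜.)
  record IsWL (col : G → ℕ) : Set where
    field
      sring   : IsSRing col
      sunion  : SUnion col
      minimal : ∀ (col' : G → ℕ) → IsSRing col' → SUnion col' →
                ∀ x y → col' x ≡ col' y → col x ≡ col y

  -- basic-set relation of ℤU ≀_{U/L} ℤ(G/L): singletons {g}, g ∈ U, and cosets Lg, g ∉ U
  WreathRel : G → G → Set
  WreathRel x y = x ≡ y ⊎ (¬ U x × ¬ U y × L (x · inv y))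

module Submission where

-- The WL-closure is the coarsest S-ring in which S is a union of basic sets, so it suffices to show that every such
-- S-ring refines the claimed partition, and that the claimed partition is such an S-ring.
-- For the first part: cb has three factorisations in S·S while every other element of S has at most two, so {cb} is
-- basic; translating S by cb isolates ca⁻¹, and then db.  The basic singletons form a subgroup, which therefore
-- contains ca, a² = (ca)² and da = (db)(cb)(ca), hence U; for odd k it contains a = (a²)^((k+1)/2) and so all of G.
-- For even k an element x ∉ U is u·c with u ∈ U, and its class lies in u·(S ∖ U) ⊆ Lx.
-- For the second part: when k is even, x ↦ (parity of the a-exponent, b + c, d) identifies G/L with Z₂³, U being the
-- preimage of the even-weight vectors, and left multiplication by an element of L on the factor outside U gives the
-- bijections between factorisations required of the structure constants.

open import Defs

open import Algebra.Bundles using (Group; CommutativeRing)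
open import Algebra.Structures using (IsGroup)
import Algebra.Properties.Group as GroupProperties
open import Axiom.UniquenessOfIdentityProofs.WithK using (uip)
open import Data.Bool using (Bool; true; false; _xor_; not; if_then_else_)
open import Data.Bool.Properties
  using (xor-assoc; xor-comm; xor-same; xor-identityʳ; not-involutive; not-distribˡ-xor; xor-∧-commutativeRing)
import Data.Bool.Properties as Bool
open import Data.Empty using (⊥; ⊥-elim)
open import Data.Fin using (Fin; toℕ)
import Data.Fin as Fin
open import Data.Fin.Properties using (toℕ-fromℕ<; toℕ<n; toℕ-injective; 2↔Bool; remQuot-combine)
open import Data.Integer using (ℤ; +_; -[1+_]; _⊖_) renaming (_+_ to _+ℤ_; -_ to -ℤ_)
open import Data.Integer.Properties using (⊖-≥; ⊖-<)
open import Data.Nat using (ℕ; NonZero; zero; suc; _+_; _∸_; _*_; _%_; _/_; _≤_; _<_; z≤n; s≤s; >-nonZero⁻¹)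
import Data.Nat as ℕ
open import Data.Nat.DivMod
  using (_mod_; m%n<n; m%n≤n; m≡m%n+[m/n]*n; [m+n]%n≡m%n; %-distribˡ-+; m%n%n≡m%n; n%n≡0; m<n⇒m%n≡m)
open import Data.Nat.Divisibility using (_∣_; divides)
open import Data.Nat.Properties
  using (_<?_; ≤-trans; <⇒≤; ≮⇒≥; <⇒≢; ∸-monoʳ-<; +-assoc; +-comm; +-identityʳ; +-suc; *-assoc; *-identityʳ;
         *-distribʳ-+; m+[n∸m]≡n; m∸n+n≡m; +-commutativeSemigroup)
open import Algebra.Properties.CommutativeSemigroup +-commutativeSemigroup
  using () renaming (interchange to +-interchange)
open import Algebra.Properties.CommutativeSemigroup (CommutativeRing.+-commutativeSemigroup xor-∧-commutativeRing)
  using () renaming (interchange to xor-interchange)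
open import Data.Product using (Σ; _×_; _,_; proj₁; proj₂)
open import Data.Sum using (_⊎_; inj₁; inj₂; [_,_]′)
import Data.Sum
open import Function.Base using (_∘_)
open import Function.Bundles using (Inverse; Equivalence; _↔_; _⇔_; mk↔ₛ′; mk⇔)
import Function.Properties.Equivalence as ⇔
open import Function.Properties.Inverse using (↔-refl)
open import Relation.Binary.PropositionalEquality
open import Relation.Nullary using (¬_; Dec; yes; no)
open import Relation.Nullary.Decidable using (map′; _×-dec_)

-- Z₂³; the patterns are named after the elements of ⟨b, c, d⟩ whose exponent vectors they are.
Bits : Set
Bits = Bool × Bool × Bool

pattern O   = false , false , false
pattern B   = true  , false , false
pattern C   = false , true  , false
pattern D   = false , false , true
pattern BC  = true  , true  , false
pattern BD  = true  , false , true
pattern CD  = false , true  , true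
pattern BCD = true  , true  , true

infixl 6 _⊕_
_⊕_ : Bits → Bits → Bits
(j , l , m) ⊕ (j′ , l′ , m′) = j xor j′ , l xor l′ , m xor m′

xor-cancelˡ : ∀ p q → p xor (p xor q) ≡ q
xor-cancelˡ false q = refl
xor-cancelˡ true  q = not-involutive q

⊕-cancelˡ : ∀ u v → u ⊕ (u ⊕ v) ≡ v
⊕-cancelˡ (j , l , m) (j′ , l′ , m′) =
  cong₂ _,_ (xor-cancelˡ j j′) (cong₂ _,_ (xor-cancelˡ l l′) (xor-cancelˡ m m′))

⊕-solveʳ : ∀ {u v w} → u ⊕ v ≡ w → v ≡ u ⊕ w
⊕-solveʳ {u} {v} p = trans (sym (⊕-cancelˡ u v)) (cong (u ⊕_) p)

⊕-comm : ∀ u v → u ⊕ v ≡ v ⊕ u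
⊕-comm (j , l , m) (j′ , l′ , m′) = cong₂ _,_ (xor-comm j j′) (cong₂ _,_ (xor-comm l l′) (xor-comm m m′))

⊕-solveˡ : ∀ {u v w} → u ⊕ v ≡ w → u ≡ w ⊕ v
⊕-solveˡ {u} {v} {w} p = trans (⊕-solveʳ {v} {u} {w} (trans (⊕-comm v u) p)) (⊕-comm v w)

⊕-assoc : ∀ u v w → u ⊕ v ⊕ w ≡ u ⊕ (v ⊕ w)
⊕-assoc (j , l , m) (j′ , l′ , m′) (j″ , l″ , m″) =
  cong₂ _,_ (xor-assoc j j′ j″) (cong₂ _,_ (xor-assoc l l′ l″) (xor-assoc m m′ m″))

⊕-identityʳ : ∀ u → u ⊕ O ≡ u
⊕-identityʳ (j , l , m) = cong₂ _,_ (xor-identityʳ j) (cong₂ _,_ (xor-identityʳ l) (xor-identityʳ m))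

⊕-self : ∀ u → u ⊕ u ≡ O
⊕-self (j , l , m) = cong₂ _,_ (xor-same j) (cong₂ _,_ (xor-same l) (xor-same m))

odd : ℕ → Bool
odd zero    = false
odd (suc n) = not (odd n)

odd-+ : ∀ m n → odd (m + n) ≡ odd m xor odd n
odd-+ zero    n = refl
odd-+ (suc m) n = trans (cong not (odd-+ m n)) (not-distribˡ-xor (odd m) (odd n))

odd-*2 : ∀ n → odd (n * 2) ≡ false
odd-*2 zero    = refl
odd-*2 (suc n) = trans (not-involutive (odd (n * 2))) (odd-*2 n)

even⇒*2 : ∀ n → odd n ≡ false → Σ ℕ λ h → n ≡ h * 2
even⇒*2 zero          _ = 0 , refl
even⇒*2 (suc zero)    ()
even⇒*2 (suc (suc n)) p with even⇒*2 n (trans (sym (not-involutive (odd n))) p)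
... | h , n≡2h = suc h , cong (λ m → suc (suc m)) n≡2h

xor≡false⇒≡ : ∀ p q → p xor q ≡ false → p ≡ q
xor≡false⇒≡ false q p = sym p
xor≡false⇒≡ true  q p = trans (cong not (sym p)) (not-involutive q)

weight : Bits → Bool
weight (p , q , r) = p xor (q xor r)

weight-⊕ : ∀ u v → weight (u ⊕ v) ≡ weight u xor weight v
weight-⊕ (p , q , r) (p′ , q′ , r′) =
  trans (cong ((p xor p′) xor_) (xor-interchange q q′ r r′)) (xor-interchange p p′ (q xor r) (q′ xor r′))

odd⇒1+2r : ∀ {n} → ¬ (2 ∣ n) → Σ ℕ λ r → n ≡ 1 + r * 2
odd⇒1+2r {n} ¬2∣n with n % 2 | m%n<n n 2 | m≡m%n+[m/n]*n n 2
... | 0           | _               | n≡ = ⊥-elim (¬2∣n (divides (n / 2) n≡))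
... | 1           | _               | n≡ = n / 2 , n≡
... | suc (suc _) | s≤s (s≤s ())    | _

bit : Bool → Fin 2
bit = Inverse.from 2↔Bool

bit-injective : ∀ {p q} → bit p ≡ bit q → p ≡ q
bit-injective {p} {q} e =
  trans (sym (Inverse.strictlyInverseˡ 2↔Bool p)) (trans (cong (Inverse.to 2↔Bool) e) (Inverse.strictlyInverseˡ 2↔Bool q))

combine-injective : ∀ {m n} {i i′ : Fin m} {j j′ : Fin n} →
                    Fin.combine i j ≡ Fin.combine i′ j′ → (i , j) ≡ (i′ , j′)
combine-injective {n = n} {i} {i′} {j} {j′} e =
  trans (sym (remQuot-combine i j)) (trans (cong (Fin.remQuot n) e) (remQuot-combine i′ j′))

module Modular (k : ℕ) .{{_ : NonZero k}} where

  infix 4 _≈_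
  _≈_ : ℕ → ℕ → Set
  m ≈ n = m % k ≡ n % k

  ≈-reflexive : ∀ {m n} → m ≡ n → m ≈ n
  ≈-reflexive = cong (_% k)

  %-≈ : ∀ n → n % k ≈ n
  %-≈ n = m%n%n≡m%n n k

  +-cong-≈ : ∀ {m m′ n n′} → m ≈ m′ → n ≈ n′ → m + n ≈ m′ + n′
  +-cong-≈ {m} {m′} {n} {n′} p q = begin
    (m + n) % k             ≡⟨ %-distribˡ-+ m n k ⟩
    (m % k + n % k) % k     ≡⟨ cong₂ (λ u v → (u + v) % k) p q ⟩
    (m′ % k + n′ % k) % k   ≡⟨ %-distribˡ-+ m′ n′ k ⟨
    (m′ + n′) % k           ∎
    where open ≡-Reasoning

  +-congˡ-≈ : ∀ o {m n} → m ≈ n → o + m ≈ o + n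
  +-congˡ-≈ o = +-cong-≈ {o} refl

  +-congʳ-≈ : ∀ o {m n} → m ≈ n → m + o ≈ n + o
  +-congʳ-≈ o p = +-cong-≈ p (refl {x = o % k})

  0%k : 0 % k ≡ 0
  0%k = m<n⇒m%n≡m (>-nonZero⁻¹ k)

  neg : ℕ → ℕ
  neg n = k ∸ n % k

  +-neg-≈0 : ∀ n → n + neg n ≈ 0
  +-neg-≈0 n = begin
    (n + neg n) % k         ≡⟨ +-congʳ-≈ (neg n) (sym (%-≈ n)) ⟩
    (n % k + neg n) % k     ≡⟨ cong (_% k) (m+[n∸m]≡n (m%n≤n n k)) ⟩
    k % k                   ≡⟨ trans (n%n≡0 k) (sym 0%k) ⟩
    0 % k                   ∎
    where open ≡-Reasoning

  neg-cong : ∀ {m n} → m ≈ n → neg m ≡ neg n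
  neg-cong = cong (k ∸_)

  neg-unique : ∀ x y y′ → x + y ≈ 0 → x + y′ ≈ 0 → y ≈ y′
  neg-unique x y y′ p q = begin
    y % k                   ≡⟨ ≈-reflexive (sym (+-identityʳ y)) ⟩
    (y + 0) % k             ≡⟨ +-congˡ-≈ y (sym q) ⟩
    (y + (x + y′)) % k      ≡⟨ ≈-reflexive (sym (+-assoc y x y′)) ⟩
    (y + x + y′) % k        ≡⟨ +-congʳ-≈ y′ (trans (≈-reflexive (+-comm y x)) p) ⟩
    (0 + y′) % k            ∎
    where open ≡-Reasoning

  neg-involutive : ∀ n → neg (neg n) ≈ n
  neg-involutive n = neg-unique (neg n) _ n (+-neg-≈0 (neg n))
    (trans (≈-reflexive (+-comm (neg n) n)) (+-neg-≈0 n))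

  neg-+ : ∀ m n → neg (m + n) ≈ neg m + neg n
  neg-+ m n = neg-unique (m + n) _ _ (+-neg-≈0 (m + n))
    (trans (≈-reflexive (+-interchange m n (neg m) (neg n))) (+-cong-≈ (+-neg-≈0 m) (+-neg-≈0 n)))

  neg-0 : neg 0 ≈ 0
  neg-0 = neg-unique 0 (neg 0) 0 (+-neg-≈0 0) refl

  negIf : Bool → ℕ → ℕ
  negIf false n = n
  negIf true  n = neg n

  negIf-cong : ∀ j {m n} → m ≈ n → negIf j m ≈ negIf j n
  negIf-cong false p = p
  negIf-cong true  p = ≈-reflexive (neg-cong p)

  negIf-+ : ∀ j m n → negIf j (m + n) ≈ negIf j m + negIf j n
  negIf-+ false m n = refl
  negIf-+ true  m n = neg-+ m n

  negIf-negIf : ∀ j j′ n → negIf j (negIf j′ n) ≈ negIf (j xor j′) n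
  negIf-negIf false j′    n = refl
  negIf-negIf true  false n = refl
  negIf-negIf true  true  n = neg-involutive n

  negIf-0 : ∀ j → negIf j 0 ≈ 0
  negIf-0 false = refl
  negIf-0 true  = neg-0

module GroupLaws (k : ℕ) .{{_ : NonZero k}} where
  open Modular k public

  𝔾 : Set
  𝔾 = G k

  infixl 7 _∙_
  _∙_ : 𝔾 → 𝔾 → 𝔾
  _∙_ = _·_ k

  infix 8 _⁻¹
  _⁻¹ : 𝔾 → 𝔾
  _⁻¹ = inv k

  ε : 𝔾
  ε = e k

  expA : 𝔾 → ℕ
  expA x = toℕ (G.ea x)

  expA<k : ∀ x → expA x < k
  expA<k x = toℕ<n (G.ea x)

  expA-% : ∀ x → expA x % k ≡ expA x
  expA-% x = m<n⇒m%n≡m (expA<k x)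

  toℕ-mod : ∀ n → toℕ (n mod k) ≡ n % k
  toℕ-mod n = toℕ-fromℕ< _

  expA-mod : ∀ n → toℕ (n mod k) ≈ n
  expA-mod n = trans (cong (_% k) (toℕ-mod n)) (%-≈ n)

  expA-ε : expA ε ≡ 0
  expA-ε = trans (toℕ-mod 0) 0%k

  expA-∙ : ∀ x y → expA (x ∙ y) ≈ expA x + negIf (G.eb x) (expA y)
  expA-∙ x y = trans (expA-mod _) (+-congˡ-≈ (expA x) (≈-reflexive (branch (G.eb x))))
    where
    branch : ∀ j → (if j then k ∸ expA y else expA y) ≡ negIf j (expA y)
    branch false = refl
    branch true  = cong (k ∸_) (sym (expA-% y))

  expA-⁻¹ : ∀ x → expA (x ⁻¹) ≈ negIf (not (G.eb x)) (expA x)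
  expA-⁻¹ x with G.eb x
  ... | true  = expA-mod (expA x)
  ... | false = trans (expA-mod _) (cong (λ n → (k ∸ n) % k) (sym (expA-% x)))

  π : 𝔾 → Bits
  π x = G.eb x , G.ec x , G.ed x

  ≡-by-coordinates : ∀ {x y} → expA x ≈ expA y → π x ≡ π y → x ≡ y
  ≡-by-coordinates {⟨ i , j , l , m ⟩} {⟨ i′ , _ , _ , _ ⟩} p refl =
    cong (λ u → ⟨ u , j , l , m ⟩)
         (toℕ-injective (trans (sym (expA-% ⟨ i , j , l , m ⟩)) (trans p (expA-% ⟨ i′ , j , l , m ⟩))))

  ∙-assoc : ∀ x y z → (x ∙ y) ∙ z ≡ x ∙ (y ∙ z)
  ∙-assoc x y z = ≡-by-coordinates exponents (⊕-assoc (π x) (π y) (π z))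
    where
    open ≡-Reasoning
    bx = G.eb x
    by = G.eb y
    exponents : expA ((x ∙ y) ∙ z) ≈ expA (x ∙ (y ∙ z))
    exponents = begin
      expA ((x ∙ y) ∙ z) % k
        ≡⟨ expA-∙ (x ∙ y) z ⟩
      (expA (x ∙ y) + negIf (bx xor by) (expA z)) % k
        ≡⟨ +-congʳ-≈ _ (expA-∙ x y) ⟩
      (expA x + negIf bx (expA y) + negIf (bx xor by) (expA z)) % k
        ≡⟨ ≈-reflexive (+-assoc (expA x) _ _) ⟩
      (expA x + (negIf bx (expA y) + negIf (bx xor by) (expA z))) % k
        ≡⟨ +-congˡ-≈ (expA x) (+-congˡ-≈ _ (sym (negIf-negIf bx by (expA z)))) ⟩
      (expA x + (negIf bx (expA y) + negIf bx (negIf by (expA z)))) % k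
        ≡⟨ +-congˡ-≈ (expA x) (sym (negIf-+ bx (expA y) _)) ⟩
      (expA x + negIf bx (expA y + negIf by (expA z))) % k
        ≡⟨ +-congˡ-≈ (expA x) (negIf-cong bx (sym (expA-∙ y z))) ⟩
      (expA x + negIf bx (expA (y ∙ z))) % k
        ≡⟨ expA-∙ x (y ∙ z) ⟨
      expA (x ∙ (y ∙ z)) % k
        ∎

  ∙-identityˡ : ∀ x → ε ∙ x ≡ x
  ∙-identityˡ x = ≡-by-coordinates (trans (expA-∙ ε x) (≈-reflexive (cong (_+ expA x) expA-ε))) refl

  ∙-identityʳ : ∀ x → x ∙ ε ≡ x
  ∙-identityʳ x = ≡-by-coordinates exponent (⊕-identityʳ (π x))
    where
    exponent : expA (x ∙ ε) ≈ expA x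
    exponent = trans (expA-∙ x ε)
      (trans (+-congˡ-≈ (expA x) (trans (negIf-cong (G.eb x) (≈-reflexive expA-ε)) (negIf-0 (G.eb x))))
             (≈-reflexive (+-identityʳ (expA x))))

  ∙-inverseˡ : ∀ x → x ⁻¹ ∙ x ≡ ε
  ∙-inverseˡ x = ≡-by-coordinates exponent (⊕-self (π x))
    where
    cancels : ∀ j → negIf (not j) (expA x) + negIf j (expA x) ≈ 0
    cancels false = trans (≈-reflexive (+-comm _ (expA x))) (+-neg-≈0 (expA x))
    cancels true  = +-neg-≈0 (expA x)
    exponent : expA (x ⁻¹ ∙ x) ≈ expA ε
    exponent = trans (expA-∙ (x ⁻¹) x)
      (trans (+-congʳ-≈ _ (expA-⁻¹ x)) (trans (cancels (G.eb x)) (≈-reflexive (sym expA-ε))))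

  ∙-inverseʳ : ∀ x → x ∙ x ⁻¹ ≡ ε
  ∙-inverseʳ x = ≡-by-coordinates exponent (⊕-self (π x))
    where
    cancels : ∀ j → expA x + negIf j (negIf (not j) (expA x)) ≈ 0
    cancels false = +-neg-≈0 (expA x)
    cancels true  = +-neg-≈0 (expA x)
    exponent : expA (x ∙ x ⁻¹) ≈ expA ε
    exponent = trans (expA-∙ x (x ⁻¹))
      (trans (+-congˡ-≈ (expA x) (negIf-cong (G.eb x) (expA-⁻¹ x)))
             (trans (cancels (G.eb x)) (≈-reflexive (sym expA-ε))))

  isGroup : IsGroup _≡_ _∙_ ε _⁻¹
  isGroup = record
    { isMonoid = record
      { isSemigroup = record
        { isMagma = record { isEquivalence = isEquivalence ; ∙-cong = cong₂ _∙_ }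
        ; assoc = ∙-assoc }
      ; identity = ∙-identityˡ , ∙-identityʳ }
    ; inverse = ∙-inverseˡ , ∙-inverseʳ
    ; ⁻¹-cong = cong _⁻¹ }

  group : Group _ _
  group = record { isGroup = isGroup }

  open GroupProperties group public
    using (∙-cancelˡ; ∙-cancelʳ; ⁻¹-involutive; ε⁻¹≈ε; //-rightDividesˡ; \\-leftDividesˡ; \\-leftDividesʳ)

  infix 4 _≟_
  _≟_ : (x y : 𝔾) → Dec (x ≡ y)
  ⟨ i , j , l , m ⟩ ≟ ⟨ i′ , j′ , l′ , m′ ⟩ =
    map′ (λ { (refl , refl , refl , refl) → refl }) (λ { refl → refl , refl , refl , refl })
         (i Fin.≟ i′ ×-dec j Bool.≟ j′ ×-dec l Bool.≟ l′ ×-dec m Bool.≟ m′)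

  code : 𝔾 → ℕ
  code ⟨ i , j , l , m ⟩ = toℕ (Fin.combine i (Fin.combine (bit j) (Fin.combine (bit l) (bit m))))

  code-injective : ∀ {x y} → code x ≡ code y → x ≡ y
  code-injective {⟨ i , j , l , m ⟩} {⟨ i′ , j′ , l′ , m′ ⟩} e =
    ≡-by-coordinates (cong (λ u → toℕ u % k) (cong proj₁ outer))
            (cong₂ _,_ (bit-injective (cong proj₁ middle))
                       (cong₂ _,_ (bit-injective (cong proj₁ inner)) (bit-injective (cong proj₂ inner))))
    where
    outer  = combine-injective (toℕ-injective e)
    middle = combine-injective (cong proj₂ outer)
    inner  = combine-injective (cong proj₂ middle)

module Words (k : ℕ) .{{_ : NonZero k}} where
  open GroupLaws k public

  scale : ℕ → ℤ → ℕ
  scale u (+ n)    = n * u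
  scale u -[1+ n ] = neg (suc n * u)

  scale-⊖ : ∀ u m n → scale u (m ⊖ n) ≈ m * u + neg (n * u)
  scale-⊖ u m n with m <? n
  ... | no m≮n rewrite ⊖-≥ (≮⇒≥ m≮n) = sym (begin
    (m * u + neg (n * u)) % k
      ≡⟨ ≈-reflexive (cong (λ t → t * u + neg (n * u)) (sym (m∸n+n≡m (≮⇒≥ m≮n)))) ⟩
    ((m ∸ n + n) * u + neg (n * u)) % k
      ≡⟨ ≈-reflexive (cong (_+ neg (n * u)) (*-distribʳ-+ u (m ∸ n) n)) ⟩
    ((m ∸ n) * u + n * u + neg (n * u)) % k
      ≡⟨ ≈-reflexive (+-assoc ((m ∸ n) * u) (n * u) _) ⟩
    ((m ∸ n) * u + (n * u + neg (n * u))) % k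
      ≡⟨ +-congˡ-≈ ((m ∸ n) * u) (+-neg-≈0 (n * u)) ⟩
    ((m ∸ n) * u + 0) % k
      ≡⟨ ≈-reflexive (+-identityʳ _) ⟩
    ((m ∸ n) * u) % k
      ∎)
    where open ≡-Reasoning
  ... | yes m<n rewrite ⊖-< m<n = sym (begin
    (m * u + neg (n * u)) % k
      ≡⟨ +-congˡ-≈ (m * u) (≈-reflexive (cong neg (cong (_* u) (sym (m+[n∸m]≡n (<⇒≤ m<n)))))) ⟩
    (m * u + neg ((m + (n ∸ m)) * u)) % k
      ≡⟨ +-congˡ-≈ (m * u) (≈-reflexive (cong neg (*-distribʳ-+ u m (n ∸ m)))) ⟩
    (m * u + neg (m * u + (n ∸ m) * u)) % k
      ≡⟨ +-congˡ-≈ (m * u) (neg-+ (m * u) _) ⟩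
    (m * u + (neg (m * u) + neg ((n ∸ m) * u))) % k
      ≡⟨ ≈-reflexive (sym (+-assoc (m * u) _ _)) ⟩
    (m * u + neg (m * u) + neg ((n ∸ m) * u)) % k
      ≡⟨ +-congʳ-≈ _ (+-neg-≈0 (m * u)) ⟩
    neg ((n ∸ m) * u) % k
      ≡⟨ negated (n ∸ m) ⟩
    scale u (-ℤ (+ (n ∸ m))) % k
      ∎)
    where
    open ≡-Reasoning
    negated : ∀ p → neg (p * u) ≈ scale u (-ℤ (+ p))
    negated zero    = neg-0
    negated (suc p) = refl

  scale-+ : ∀ u x y → scale u (x +ℤ y) ≈ scale u x + scale u y
  scale-+ u (+ m)    (+ n)    = ≈-reflexive (*-distribʳ-+ u m n)
  scale-+ u (+ m)    -[1+ n ] = scale-⊖ u m (suc n)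
  scale-+ u -[1+ m ] (+ n)    = trans (scale-⊖ u n (suc m)) (≈-reflexive (+-comm (n * u) _))
  scale-+ u -[1+ m ] -[1+ n ] =
    trans (≈-reflexive (cong neg (trans (cong (λ t → suc t * u) (sym (+-suc m n))) (*-distribʳ-+ u (suc m) (suc n)))))
          (neg-+ (suc m * u) (suc n * u))

  scale-neg : ∀ u x → scale u (-ℤ x) ≈ neg (scale u x)
  scale-neg u (+ zero)  = sym neg-0
  scale-neg u (+ suc n) = refl
  scale-neg u -[1+ n ]  = sym (neg-involutive (suc n * u))

  negIfℤ : Bool → ℤ → ℤ
  negIfℤ false x = x
  negIfℤ true  x = -ℤ x

  scale-negIf : ∀ u j x → scale u (negIfℤ j x) ≈ negIf j (scale u x)
  scale-negIf u false x = refl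
  scale-negIf u true  x = scale-neg u x

  infixl 7 _`∙_
  infix 8 _`⁻¹
  data Word : Set where
    `a `b `c `d `e `v : Word
    _`∙_ : Word → Word → Word
    _`⁻¹ : Word → Word

  ⟦_⟧ : Word → 𝔾 → 𝔾
  ⟦ `a ⟧      v = a k
  ⟦ `b ⟧      v = b k
  ⟦ `c ⟧      v = c k
  ⟦ `d ⟧      v = d k
  ⟦ `e ⟧      v = ε
  ⟦ `v ⟧      v = v
  ⟦ x `∙ y ⟧  v = ⟦ x ⟧ v ∙ ⟦ y ⟧ v
  ⟦ x `⁻¹ ⟧   v = ⟦ x ⟧ v ⁻¹

  -- a^powA v^powV b^j c^l d^m with (j , l , m) = bits; words are only evaluated at v ∈ ⟨a⟩.
  record NormalForm : Set where
    constructor nf⟨_,_,_⟩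
    field
      powA powV : ℤ
      bits      : Bits
  open NormalForm

  normalise : Word → NormalForm
  normalise `a = nf⟨ + 1 , + 0 , O ⟩
  normalise `b = nf⟨ + 0 , + 0 , B ⟩
  normalise `c = nf⟨ + 0 , + 0 , C ⟩
  normalise `d = nf⟨ + 0 , + 0 , D ⟩
  normalise `e = nf⟨ + 0 , + 0 , O ⟩
  normalise `v = nf⟨ + 0 , + 1 , O ⟩
  normalise (x `∙ y) =
    let j = proj₁ (bits (normalise x)) in
    nf⟨ powA (normalise x) +ℤ negIfℤ j (powA (normalise y))
      , powV (normalise x) +ℤ negIfℤ j (powV (normalise y))
      , bits (normalise x) ⊕ bits (normalise y) ⟩
  normalise (x `⁻¹) =
    let j = not (proj₁ (bits (normalise x))) in
    nf⟨ negIfℤ j (powA (normalise x)) , negIfℤ j (powV (normalise x)) , bits (normalise x) ⟩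

  module Evaluation (v : 𝔾) (v∈A : π v ≡ O) where

    value : NormalForm → ℕ
    value n = scale 1 (powA n) + scale (expA v) (powV n)

    π-⟦⟧ : ∀ w → π (⟦ w ⟧ v) ≡ bits (normalise w)
    π-⟦⟧ `a = refl
    π-⟦⟧ `b = refl
    π-⟦⟧ `c = refl
    π-⟦⟧ `d = refl
    π-⟦⟧ `e = refl
    π-⟦⟧ `v = v∈A
    π-⟦⟧ (x `∙ y) = cong₂ _⊕_ (π-⟦⟧ x) (π-⟦⟧ y)
    π-⟦⟧ (x `⁻¹)  = π-⟦⟧ x

    value-∙ : ∀ j m n → value (nf⟨ powA m +ℤ negIfℤ j (powA n) , powV m +ℤ negIfℤ j (powV n) , O ⟩)
                      ≈ value m + negIf j (value n)
    value-∙ j m n = begin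
      (scale 1 (powA m +ℤ negIfℤ j (powA n)) + scale (expA v) (powV m +ℤ negIfℤ j (powV n))) % k
        ≡⟨ +-cong-≈ (scale-+ 1 (powA m) _) (scale-+ (expA v) (powV m) _) ⟩
      (scale 1 (powA m) + scale 1 (negIfℤ j (powA n)) + (scale (expA v) (powV m) + scale (expA v) (negIfℤ j (powV n)))) % k
        ≡⟨ +-cong-≈ (+-congˡ-≈ (scale 1 (powA m)) (scale-negIf 1 j (powA n)))
                    (+-congˡ-≈ (scale (expA v) (powV m)) (scale-negIf (expA v) j (powV n))) ⟩
      (scale 1 (powA m) + negIf j (scale 1 (powA n)) + (scale (expA v) (powV m) + negIf j (scale (expA v) (powV n)))) % k
        ≡⟨ ≈-reflexive (+-interchange (scale 1 (powA m)) _ _ _) ⟩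
      (value m + (negIf j (scale 1 (powA n)) + negIf j (scale (expA v) (powV n)))) % k
        ≡⟨ +-congˡ-≈ (value m) (negIf-+ j _ _) ⟨
      (value m + negIf j (value n)) % k
        ∎
      where open ≡-Reasoning

    value-⁻¹ : ∀ j n → value (nf⟨ negIfℤ j (powA n) , negIfℤ j (powV n) , O ⟩) ≈ negIf j (value n)
    value-⁻¹ j n = trans (+-cong-≈ (scale-negIf 1 j (powA n)) (scale-negIf (expA v) j (powV n)))
                         (sym (negIf-+ j _ _))

    expA-⟦⟧ : ∀ w → expA (⟦ w ⟧ v) ≈ value (normalise w)
    expA-⟦⟧ `a = expA-mod 1
    expA-⟦⟧ `b = expA-mod 0
    expA-⟦⟧ `c = expA-mod 0
    expA-⟦⟧ `d = expA-mod 0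
    expA-⟦⟧ `e = expA-mod 0
    expA-⟦⟧ `v = ≈-reflexive (sym (+-identityʳ (expA v)))
    expA-⟦⟧ (x `∙ y) = begin
      expA (⟦ x ⟧ v ∙ ⟦ y ⟧ v) % k
        ≡⟨ expA-∙ (⟦ x ⟧ v) (⟦ y ⟧ v) ⟩
      (expA (⟦ x ⟧ v) + negIf (G.eb (⟦ x ⟧ v)) (expA (⟦ y ⟧ v))) % k
        ≡⟨ ≈-reflexive (cong (λ j → expA (⟦ x ⟧ v) + negIf j (expA (⟦ y ⟧ v))) (cong proj₁ (π-⟦⟧ x))) ⟩
      (expA (⟦ x ⟧ v) + negIf j (expA (⟦ y ⟧ v))) % k
        ≡⟨ +-cong-≈ (expA-⟦⟧ x) (negIf-cong j (expA-⟦⟧ y)) ⟩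
      (value (normalise x) + negIf j (value (normalise y))) % k
        ≡⟨ value-∙ j (normalise x) (normalise y) ⟨
      value (normalise (x `∙ y)) % k
        ∎
      where
      open ≡-Reasoning
      j = proj₁ (bits (normalise x))
    expA-⟦⟧ (x `⁻¹) = begin
      expA (⟦ x ⟧ v ⁻¹) % k
        ≡⟨ expA-⁻¹ (⟦ x ⟧ v) ⟩
      negIf (not (G.eb (⟦ x ⟧ v))) (expA (⟦ x ⟧ v)) % k
        ≡⟨ ≈-reflexive (cong (λ j → negIf (not j) (expA (⟦ x ⟧ v))) (cong proj₁ (π-⟦⟧ x))) ⟩
      negIf j (expA (⟦ x ⟧ v)) % k
        ≡⟨ negIf-cong j (expA-⟦⟧ x) ⟩
      negIf j (value (normalise x)) % k
        ≡⟨ value-⁻¹ j (normalise x) ⟨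
      value (normalise (x `⁻¹)) % k
        ∎
      where
      open ≡-Reasoning
      j = not (proj₁ (bits (normalise x)))

    solve : ∀ w w′ → normalise w ≡ normalise w′ → ⟦ w ⟧ v ≡ ⟦ w′ ⟧ v
    solve w w′ p = ≡-by-coordinates (trans (expA-⟦⟧ w) (trans (≈-reflexive (cong value p)) (sym (expA-⟦⟧ w′))))
                           (trans (π-⟦⟧ w) (trans (cong bits p) (sym (π-⟦⟧ w′))))

    ≡⇒value-≈ : ∀ {w w′} → ⟦ w ⟧ v ≡ ⟦ w′ ⟧ v → value (normalise w) ≈ value (normalise w′)
    ≡⇒value-≈ {w} {w′} p = trans (sym (expA-⟦⟧ w)) (trans (≈-reflexive (cong expA p)) (expA-⟦⟧ w′))

  solve₀ : ∀ w w′ → normalise w ≡ normalise w′ → ⟦ w ⟧ ε ≡ ⟦ w′ ⟧ ε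
  solve₀ = Evaluation.solve ε refl

module Subgroups (k : ℕ) .{{_ : NonZero k}} where
  open Words k public

  record IsSubgroup (Q : 𝔾 → Set) : Set where
    field
      ε-closed  : Q ε
      ∙-closed  : ∀ {x y} → Q x → Q y → Q (x ∙ y)
      ⁻¹-closed : ∀ {x} → Q x → Q (x ⁻¹)

  Gen-⊆ : ∀ {P Q : 𝔾 → Set} → IsSubgroup Q → (∀ {x} → P x → Q x) → ∀ {x} → Gen k P x → Q x
  Gen-⊆ Q P⊆Q gen-e         = IsSubgroup.ε-closed Q
  Gen-⊆ Q P⊆Q (gen-in p)    = P⊆Q p
  Gen-⊆ Q P⊆Q (gen-mul p q) = IsSubgroup.∙-closed Q (Gen-⊆ Q P⊆Q p) (Gen-⊆ Q P⊆Q q)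
  Gen-⊆ Q P⊆Q (gen-inv p)   = IsSubgroup.⁻¹-closed Q (Gen-⊆ Q P⊆Q p)

  Gen-isSubgroup : ∀ {P} → IsSubgroup (Gen k P)
  Gen-isSubgroup = record { ε-closed = gen-e ; ∙-closed = gen-mul ; ⁻¹-closed = gen-inv }

  kernel-isSubgroup : (h : 𝔾 → Bits) → h ε ≡ O → (∀ x y → h (x ∙ y) ≡ h x ⊕ h y) →
                      (∀ x → h (x ⁻¹) ≡ h x) → IsSubgroup (λ x → h x ≡ O)
  kernel-isSubgroup h h-ε h-∙ h-⁻¹ = record
    { ε-closed  = h-ε
    ; ∙-closed  = λ {x} {y} p q → trans (h-∙ x y) (cong₂ _⊕_ p q)
    ; ⁻¹-closed = λ {x} p → trans (h-⁻¹ x) p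
    }

  π-A : ∀ {x} → A k x → π x ≡ O
  π-A = Gen-⊆ (kernel-isSubgroup π refl (λ _ _ → refl) (λ _ → refl)) λ { refl → refl }

  solveA : ∀ {t} → A k t → ∀ w w′ → normalise w ≡ normalise w′ → ⟦ w ⟧ t ≡ ⟦ w′ ⟧ t
  solveA {t} At = Evaluation.solve t (π-A At)

  aPow : ℕ → 𝔾
  aPow n = ⟨ n mod k , false , false , false ⟩

  aPow-+ : ∀ m n → aPow m ∙ aPow n ≡ aPow (m + n)
  aPow-+ m n = ≡-by-coordinates
    (trans (expA-∙ (aPow m) (aPow n)) (trans (+-cong-≈ (expA-mod m) (expA-mod n)) (sym (expA-mod (m + n))))) refl

  aPow-cong : ∀ {m n} → m ≈ n → aPow m ≡ aPow n
  aPow-cong {m} {n} p = ≡-by-coordinates (trans (expA-mod m) (trans p (sym (expA-mod n)))) refl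

  aPow-expA : ∀ {x} → π x ≡ O → x ≡ aPow (expA x)
  aPow-expA {x} p = ≡-by-coordinates (sym (expA-mod (expA x))) p

  aPow-closed : ∀ {Q m} → IsSubgroup Q → Q (aPow m) → ∀ n → Q (aPow (n * m))
  aPow-closed Q Qm zero    = IsSubgroup.ε-closed Q
  aPow-closed {Q} {m} Qs Qm (suc n) = subst Q (aPow-+ m (n * m)) (IsSubgroup.∙-closed Qs Qm (aPow-closed Qs Qm n))

  aPow∈A : ∀ n → A k (aPow n)
  aPow∈A n = subst (A k) (cong aPow (*-identityʳ n)) (aPow-closed Gen-isSubgroup (gen-in refl) n)

  A-intro : ∀ {x} → π x ≡ O → A k x
  A-intro {x} p = subst (A k) (sym (aPow-expA p)) (aPow∈A (expA x))

  bits-element : Bits → 𝔾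
  bits-element (j , l , m) = ⟨ 0 mod k , j , l , m ⟩

  ⟦⟧-bits-element : ∀ {t} w → normalise w ≡ nf⟨ + 0 , + 0 , t ⟩ → ⟦ w ⟧ ε ≡ bits-element t
  ⟦⟧-bits-element w p = ≡-by-coordinates (trans (Evaluation.expA-⟦⟧ ε refl w)
                                  (trans (≈-reflexive (cong (Evaluation.value ε refl) p)) (sym (expA-mod 0))))
                                (trans (Evaluation.π-⟦⟧ ε refl w) (cong NormalForm.bits p))

  aPow-bits : ∀ x → x ≡ aPow (expA x) ∙ bits-element (π x)
  aPow-bits x = ≡-by-coordinates (sym (trans (expA-∙ (aPow (expA x)) (bits-element (π x)))
                                    (trans (+-cong-≈ (expA-mod (expA x)) (expA-mod 0)) (≈-reflexive (+-identityʳ (expA x))))))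
                        refl

  generated-by-abcd : ∀ {Q} → IsSubgroup Q → Q (a k) → Q (b k) → Q (c k) → Q (d k) → ∀ x → Q x
  generated-by-abcd {Q} Qs Qa Qb Qc Qd x =
    subst Q (sym (aPow-bits x)) (∙-closed (subst Q (cong aPow (*-identityʳ (expA x))) (aPow-closed Qs Qa (expA x))) (Q-bits (π x)))
    where
    open IsSubgroup Qs
    from-word : ∀ {t} w → normalise w ≡ nf⟨ + 0 , + 0 , t ⟩ → Q (⟦ w ⟧ ε) → Q (bits-element t)
    from-word w p = subst Q (⟦⟧-bits-element w p)
    Q-bits : ∀ t → Q (bits-element t)
    Q-bits O   = from-word `e refl ε-closed
    Q-bits B   = from-word `b refl Qb
    Q-bits C   = from-word `c refl Qc
    Q-bits D   = from-word `d refl Qd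
    Q-bits BC  = from-word (`b `∙ `c) refl (∙-closed Qb Qc)
    Q-bits BD  = from-word (`b `∙ `d) refl (∙-closed Qb Qd)
    Q-bits CD  = from-word (`c `∙ `d) refl (∙-closed Qc Qd)
    Q-bits BCD = from-word (`b `∙ `c `∙ `d) refl (∙-closed (∙-closed Qb Qc) Qd)

module ConnectionSet (k : ℕ) .{{_ : NonZero k}} (k≥3 : 3 ≤ k) where
  open Subgroups k public

  1<k : 1 < k
  1<k = ≤-trans (s≤s (s≤s z≤n)) k≥3

  a≢ε : a k ≢ ε
  a≢ε p = 1≢0 (trans (sym (m<n⇒m%n≡m 1<k)) (trans (Evaluation.≡⇒value-≈ ε refl {`a} {`e} p) 0%k))
    where
    1≢0 : 1 ≢ 0
    1≢0 ()

  1≉neg1 : ¬ (1 ≈ neg 1)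
  1≉neg1 p = <⇒≢ k≥3 (sym k≡2)
    where
    1≡k∸1 : 1 ≡ k ∸ 1
    1≡k∸1 = begin
      1               ≡⟨ m<n⇒m%n≡m 1<k ⟨
      1 % k           ≡⟨ p ⟩
      neg 1 % k       ≡⟨ cong (λ n → (k ∸ n) % k) (m<n⇒m%n≡m 1<k) ⟩
      (k ∸ 1) % k     ≡⟨ m<n⇒m%n≡m (∸-monoʳ-< {k} {1} {0} (s≤s z≤n) (<⇒≤ 1<k)) ⟩
      k ∸ 1           ∎
      where open ≡-Reasoning
    k≡2 : k ≡ 2
    k≡2 = trans (sym (m+[n∸m]≡n (<⇒≤ 1<k))) (cong suc (sym 1≡k∸1))

  a≢a⁻¹ : a k ≢ a k ⁻¹
  a≢a⁻¹ p = 1≉neg1 (trans (Evaluation.≡⇒value-≈ ε refl {`a} {`a `⁻¹} p) (≈-reflexive (+-identityʳ (neg 1))))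

  cb db dcba⁻¹ ca : 𝔾
  cb     = c k ∙ b k
  db     = d k ∙ b k
  dcba⁻¹ = d k ∙ c k ∙ b k ∙ a k ⁻¹
  ca     = c k ∙ a k

  π-bA : ∀ {t} → A k t → π (b k ∙ t) ≡ B
  π-bA At = cong (B ⊕_) (π-A At)

  π-cA : ∀ {t} → A k t → π (c k ∙ t) ≡ C
  π-cA At = cong (C ⊕_) (π-A At)

  ε≢a⁻¹ : ε ≢ a k ⁻¹
  ε≢a⁻¹ p = a≢ε (trans (sym (⁻¹-involutive (a k))) (trans (cong _⁻¹ (sym p)) ε⁻¹≈ε))

  b∈S : S k (b k)
  b∈S = inj₁ (ε , gen-e , ε≢a⁻¹ , sym (∙-identityʳ (b k)))

  c∈S : S k (c k)
  c∈S = inj₂ (inj₁ (ε , gen-e , sym (∙-identityʳ (c k))))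

  ba∈S : S k (b k ∙ a k)
  ba∈S = inj₁ (a k , gen-in refl , a≢a⁻¹ , refl)

  ca∈S : S k ca
  ca∈S = inj₂ (inj₁ (a k , gen-in refl , refl))

  ca⁻¹∈S : S k (ca ⁻¹)
  ca⁻¹∈S = inj₂ (inj₁ (a k ⁻¹ , gen-inv (gen-in refl) , solve₀ ((`c `∙ `a) `⁻¹) (`c `∙ `a `⁻¹) refl))

  cb∈S : S k cb
  cb∈S = inj₂ (inj₂ (inj₁ refl))

  db∈S : S k db
  db∈S = inj₂ (inj₂ (inj₂ (inj₁ refl)))

  dcba⁻¹∈S : S k dcba⁻¹
  dcba⁻¹∈S = inj₂ (inj₂ (inj₂ (inj₂ refl)))

  data πS : Bits → Set where
    inB   : πS B
    inC   : πS C
    inBC  : πS BC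
    inBD  : πS BD
    inBCD : πS BCD

  π-S : ∀ {x} → S k x → πS (π x)
  π-S (inj₁ (t , At , _ , refl))          = subst πS (sym (π-bA At)) inB
  π-S (inj₂ (inj₁ (t , At , refl)))       = subst πS (sym (π-cA At)) inC
  π-S (inj₂ (inj₂ (inj₁ refl)))           = inBC
  π-S (inj₂ (inj₂ (inj₂ (inj₁ refl))))    = inBD
  π-S (inj₂ (inj₂ (inj₂ (inj₂ refl))))    = inBCD

  data Rigid : Bits → Set where
    rBC  : Rigid BC
    rBD  : Rigid BD
    rBCD : Rigid BCD

  rigid-element : ∀ {t} → Rigid t → 𝔾
  rigid-element rBC  = cb
  rigid-element rBD  = db
  rigid-element rBCD = dcba⁻¹

  S-fibre : ∀ {x t} → S k x → (r : Rigid t) → π x ≡ t → x ≡ rigid-element r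
  S-fibre (inj₁ (t , At , _ , refl))       r    p    = ⊥-elim (B-flexible (subst Rigid (trans (sym p) (π-bA At)) r))
    where
    B-flexible : ¬ Rigid B
    B-flexible ()
  S-fibre (inj₂ (inj₁ (t , At , refl)))    r    p    = ⊥-elim (C-flexible (subst Rigid (trans (sym p) (π-cA At)) r))
    where
    C-flexible : ¬ Rigid C
    C-flexible ()
  S-fibre (inj₂ (inj₂ (inj₁ refl)))        rBC  refl = refl
  S-fibre (inj₂ (inj₂ (inj₂ (inj₁ refl)))) rBD  refl = refl
  S-fibre (inj₂ (inj₂ (inj₂ (inj₂ refl)))) rBCD refl = refl

  S-rigid : ∀ {x y} → S k x → S k y → π x ≡ π y → Rigid (π x) → x ≡ y
  S-rigid Sx Sy p r = trans (S-fibre Sx r refl) (sym (S-fibre Sy r (sym p)))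

  S-B : ∀ {x} → S k x → π x ≡ B → Σ 𝔾 λ t → A k t × t ≢ a k ⁻¹ × x ≡ b k ∙ t
  S-B (inj₁ r)                             _ = r
  S-B (inj₂ (inj₁ (t , At , refl)))        p = ⊥-elim (C≢B (trans (sym (π-cA At)) p))
    where
    C≢B : C ≢ B
    C≢B ()
  S-B (inj₂ (inj₂ (inj₁ refl)))            ()
  S-B (inj₂ (inj₂ (inj₂ (inj₁ refl))))     ()
  S-B (inj₂ (inj₂ (inj₂ (inj₂ refl))))     ()

  Factorisation : 𝔾 → Set
  Factorisation z = Σ (𝔾 × 𝔾) λ p → S k (proj₁ p) × S k (proj₂ p) × proj₁ p ∙ proj₂ p ≡ z

  module _ {z : 𝔾} (u : Factorisation z) where
    left right : 𝔾
    left  = proj₁ (proj₁ u)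
    right = proj₂ (proj₁ u)

    left∈S : S k left
    left∈S = proj₁ (proj₂ u)

    right∈S : S k right
    right∈S = proj₁ (proj₂ (proj₂ u))

    factors : left ∙ right ≡ z
    factors = proj₂ (proj₂ (proj₂ u))

    π-factors : π z ≡ π left ⊕ π right
    π-factors = cong π (sym factors)

    π-right : π right ≡ π left ⊕ π z
    π-right = ⊕-solveʳ {π left} {π right} {π z} (sym π-factors)

  factor-rigid : ∀ {s t} → πS s → πS t → πS (s ⊕ t) → s ⊕ t ≢ BC → Rigid s ⊎ Rigid t
  factor-rigid inBC  _     _  _  = inj₁ rBC
  factor-rigid inBD  _     _  _  = inj₁ rBD
  factor-rigid inBCD _     _  _  = inj₁ rBCD
  factor-rigid inB   inBC  _  _  = inj₂ rBC
  factor-rigid inB   inBD  _  _  = inj₂ rBD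
  factor-rigid inB   inBCD _  _  = inj₂ rBCD
  factor-rigid inC   inBC  _  _  = inj₂ rBC
  factor-rigid inC   inBD  _  _  = inj₂ rBD
  factor-rigid inC   inBCD _  _  = inj₂ rBCD
  factor-rigid inB   inB   () _
  factor-rigid inC   inC   () _
  factor-rigid inB   inC   _  ≢BC = ⊥-elim (≢BC refl)
  factor-rigid inC   inB   _  ≢BC = ⊥-elim (≢BC refl)

  -- Away from cb one of the two factors always has a bit pattern taken by a single element of S.
  factorisation-unique : ∀ {z} → S k z → z ≢ cb → (u v : Factorisation z) →
                         π (left u) ≡ π (left v) → proj₁ u ≡ proj₁ v
  factorisation-unique {z} Sz z≢cb u v p with factor-rigid (π-S (left∈S u)) (π-S (right∈S u))
                                                   (subst πS (π-factors u) (π-S Sz))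
                                                   (λ q → z≢cb (S-fibre Sz rBC (trans (π-factors u) q)))
  ... | inj₁ rx =
    cong₂ _,_ left≡ (∙-cancelˡ (left u) _ _ (trans (factors u) (sym (trans (cong (_∙ right v) left≡) (factors v)))))
    where
    left≡ : left u ≡ left v
    left≡ = S-rigid (left∈S u) (left∈S v) p rx
  ... | inj₂ ry =
    cong₂ _,_ (∙-cancelʳ (right u) _ _ (trans (factors u) (sym (trans (cong (left v ∙_) right≡) (factors v))))) right≡
    where
    right≡ : right u ≡ right v
    right≡ = S-rigid (right∈S u) (right∈S v) (trans (π-right u) (trans (cong (_⊕ π z) p) (sym (π-right v)))) ry

  C-only-b-free : ∀ {t} → πS t → proj₁ t ≡ false → t ≡ C
  C-only-b-free inC   refl = refl
  C-only-b-free inB   ()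
  C-only-b-free inBC  ()
  C-only-b-free inBD  ()
  C-only-b-free inBCD ()

  b-bit-determines : ∀ {s t} → proj₁ s ≡ true → πS t → πS (t ⊕ s) → t ≡ (if proj₁ t then C ⊕ s else C)
  b-bit-determines {true , _} {false , _} refl St _   = C-only-b-free St refl
  b-bit-determines {true , _} {true  , _} refl _  Sts = ⊕-solveˡ (C-only-b-free Sts refl)

  data CShape : Bits → Set where
    sB   : CShape B
    sBC  : CShape BC
    sBD  : CShape BD
    sBCD : CShape BCD

  C-shape : ∀ {t} → πS t → πS (t ⊕ C) → CShape t
  C-shape inB   _  = sB
  C-shape inBC  _  = sBC
  C-shape inBD  _  = sBD
  C-shape inBCD _  = sBCD
  C-shape inC   ()

  data Conflict : Bits → Bits → Set where
    B-BCD : Conflict B BCD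
    BCD-B : Conflict BCD B
    BC-BD : Conflict BC BD
    BD-BC : Conflict BD BC

  -- κ (π z) (π x) separates the (at most two) factorisations z = x y with x, y ∈ S.
  κ : Bits → Bits → Bool
  κ (true  , _)     (j , _)     = j
  κ (false , _)     (_ , l , m) = l xor m

  κ-C : ∀ {t t′} → CShape t → CShape t′ → κ C t ≡ κ C t′ → t ≡ t′ ⊎ Conflict t t′
  κ-C sB   sB   _  = inj₁ refl
  κ-C sBC  sBC  _  = inj₁ refl
  κ-C sBD  sBD  _  = inj₁ refl
  κ-C sBCD sBCD _  = inj₁ refl
  κ-C sB   sBCD _  = inj₂ B-BCD
  κ-C sBCD sB   _  = inj₂ BCD-B
  κ-C sBC  sBD  _  = inj₂ BC-BD
  κ-C sBD  sBC  _  = inj₂ BD-BC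
  κ-C sB   sBC  ()
  κ-C sB   sBD  ()
  κ-C sBC  sB   ()
  κ-C sBC  sBCD ()
  κ-C sBD  sB   ()
  κ-C sBD  sBCD ()
  κ-C sBCD sBC  ()
  κ-C sBCD sBD  ()

  determined-by-b-bit : ∀ {s t t′} → proj₁ s ≡ true → πS t → πS (t ⊕ s) → πS t′ → πS (t′ ⊕ s) →
                        proj₁ t ≡ proj₁ t′ → t ≡ t′
  determined-by-b-bit {s} b St Sts St′ St′s q =
    trans (b-bit-determines b St Sts) (trans (cong (λ j → if j then C ⊕ s else C) q) (sym (b-bit-determines b St′ St′s)))

  left-bits-agree : ∀ {s t t′} → πS s → s ≢ BC → πS t → πS (t ⊕ s) → πS t′ → πS (t′ ⊕ s) →
                    κ s t ≡ κ s t′ →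
                    t ≡ t′ ⊎ (s ≡ C × Conflict t t′)
  left-bits-agree inBC  ≢BC _  _   _   _    _ = ⊥-elim (≢BC refl)
  left-bits-agree inC   _   St Sts St′ St′s q = Data.Sum.map₂ (refl ,_) (κ-C (C-shape St Sts) (C-shape St′ St′s) q)
  left-bits-agree inB   _   St Sts St′ St′s q = inj₁ (determined-by-b-bit refl St Sts St′ St′s q)
  left-bits-agree inBD  _   St Sts St′ St′s q = inj₁ (determined-by-b-bit refl St Sts St′ St′s q)
  left-bits-agree inBCD _   St Sts St′ St′s q = inj₁ (determined-by-b-bit refl St Sts St′ St′s q)

  -- (bt)(cb) = ct⁻¹ and (dcba⁻¹)(db) = ca, so both factorisations would force t = a⁻¹.
  no-b-with-dcba⁻¹ : ∀ {z} → π z ≡ C → (u v : Factorisation z) → π (left u) ≡ B → π (left v) ≡ BCD → ⊥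
  no-b-with-dcba⁻¹ {z} πz u v πu πv with S-B (left∈S u) πu
  ... | t , At , t≢a⁻¹ , left≡bt = t≢a⁻¹ (trans (sym (⁻¹-involutive t)) (cong _⁻¹ t⁻¹≡a))
    where
    right-u : right u ≡ cb
    right-u = S-fibre (right∈S u) rBC (trans (π-right u) (cong₂ _⊕_ πu πz))
    left-v : left v ≡ dcba⁻¹
    left-v = S-fibre (left∈S v) rBCD πv
    right-v : right v ≡ db
    right-v = S-fibre (right∈S v) rBD (trans (π-right v) (cong₂ _⊕_ πv πz))
    via-u : z ≡ c k ∙ t ⁻¹
    via-u = trans (sym (factors u))
                  (trans (cong₂ _∙_ left≡bt right-u) (solveA At ((`b `∙ `v) `∙ (`c `∙ `b)) (`c `∙ `v `⁻¹) refl))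
    via-v : z ≡ c k ∙ a k
    via-v = trans (sym (factors v))
                  (trans (cong₂ _∙_ left-v right-v) (solve₀ ((`d `∙ `c `∙ `b `∙ `a `⁻¹) `∙ (`d `∙ `b)) (`c `∙ `a) refl))
    t⁻¹≡a : t ⁻¹ ≡ a k
    t⁻¹≡a = ∙-cancelˡ (c k) _ _ (trans (sym via-u) via-v)

  -- (cb)(bt) = ct and (db)(dcba⁻¹) = ca⁻¹.
  no-cb-with-db : ∀ {z} → π z ≡ C → (u v : Factorisation z) → π (left u) ≡ BC → π (left v) ≡ BD → ⊥
  no-cb-with-db {z} πz u v πu πv with S-B (right∈S u) (trans (π-right u) (cong₂ _⊕_ πu πz))
  ... | t , At , t≢a⁻¹ , right≡bt = t≢a⁻¹ (∙-cancelˡ (c k) _ _ (trans (sym via-u) via-v))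
    where
    left-u : left u ≡ cb
    left-u = S-fibre (left∈S u) rBC πu
    left-v : left v ≡ db
    left-v = S-fibre (left∈S v) rBD πv
    right-v : right v ≡ dcba⁻¹
    right-v = S-fibre (right∈S v) rBCD (trans (π-right v) (cong₂ _⊕_ πv πz))
    via-u : z ≡ c k ∙ t
    via-u = trans (sym (factors u))
                  (trans (cong₂ _∙_ left-u right≡bt) (solveA At ((`c `∙ `b) `∙ (`b `∙ `v)) (`c `∙ `v) refl))
    via-v : z ≡ c k ∙ a k ⁻¹
    via-v = trans (sym (factors v))
                  (trans (cong₂ _∙_ left-v right-v) (solve₀ ((`d `∙ `b) `∙ (`d `∙ `c `∙ `b `∙ `a `⁻¹)) (`c `∙ `a `⁻¹) refl))

  no-conflict : ∀ {z t t′} → π z ≡ C → (u v : Factorisation z) →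
                π (left u) ≡ t → π (left v) ≡ t′ → ¬ Conflict t t′
  no-conflict πz u v πu πv B-BCD = no-b-with-dcba⁻¹ πz u v πu πv
  no-conflict πz u v πu πv BCD-B = no-b-with-dcba⁻¹ πz v u πv πu
  no-conflict πz u v πu πv BC-BD = no-cb-with-db πz u v πu πv
  no-conflict πz u v πu πv BD-BC = no-cb-with-db πz v u πv πu

  κ-separates : ∀ {z} → S k z → z ≢ cb → (u v : Factorisation z) →
                κ (π z) (π (left u)) ≡ κ (π z) (π (left v)) → proj₁ u ≡ proj₁ v
  κ-separates {z} Sz z≢cb u v q
    with left-bits-agree (π-S Sz) (λ p → z≢cb (S-fibre Sz rBC p))
                         (π-S (left∈S u)) (subst πS (π-right u) (π-S (right∈S u)))
                         (π-S (left∈S v)) (subst πS (π-right v) (π-S (right∈S v))) q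
  ... | inj₁ p               = factorisation-unique Sz z≢cb u v p
  ... | inj₂ (πz , conflict) = ⊥-elim (no-conflict πz u v refl refl conflict)

  record ThreeFactorisations (z : 𝔾) : Set where
    field
      u₁ u₂ u₃ : Factorisation z
      u₁≢u₂    : proj₁ u₁ ≢ proj₁ u₂
      u₁≢u₃    : proj₁ u₁ ≢ proj₁ u₃
      u₂≢u₃    : proj₁ u₂ ≢ proj₁ u₃

  bool-pigeonhole : ∀ (p q r : Bool) → p ≡ q ⊎ p ≡ r ⊎ q ≡ r
  bool-pigeonhole false false _     = inj₁ refl
  bool-pigeonhole true  true  _     = inj₁ refl
  bool-pigeonhole false true  false = inj₂ (inj₁ refl)
  bool-pigeonhole true  false true  = inj₂ (inj₁ refl)
  bool-pigeonhole false true  true  = inj₂ (inj₂ refl)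
  bool-pigeonhole true  false false = inj₂ (inj₂ refl)

  at-most-two-factorisations : ∀ {z} → S k z → z ≢ cb → ¬ ThreeFactorisations z
  at-most-two-factorisations {z} Sz z≢cb three =
    [ u₁≢u₂ ∘ separate u₁ u₂ , [ u₁≢u₃ ∘ separate u₁ u₃ , u₂≢u₃ ∘ separate u₂ u₃ ]′ ]′
      (bool-pigeonhole (label u₁) (label u₂) (label u₃))
    where
    open ThreeFactorisations three
    label : Factorisation z → Bool
    label u = κ (π z) (π (left u))
    separate : ∀ u v → label u ≡ label v → proj₁ u ≡ proj₁ v
    separate = κ-separates Sz z≢cb

Pairs-≡ : ∀ {k} .{{_ : NonZero k}} {col x₀ y₀ z} (p q : Pairs k col x₀ y₀ z) → proj₁ p ≡ proj₁ q → p ≡ q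
Pairs-≡ (_ , r₁ , r₂ , r₃) (_ , s₁ , s₂ , s₃) refl rewrite uip r₁ s₁ | uip r₂ s₂ | uip r₃ s₃ = refl

module SchurRing (k : ℕ) .{{_ : NonZero k}} (k≥3 : 3 ≤ k)
                 (col : G k → ℕ) (isSRing : IsSRing k col) (S-union : SUnion k col) where
  open ConnectionSet k k≥3 public
  open IsSRing isSRing

  Singleton : 𝔾 → Set
  Singleton x = ∀ y → col x ≡ col y → x ≡ y

  transfer : ∀ {x y z z′} → x ∙ y ≡ z → col z ≡ col z′ → Pairs k col x y z′
  transfer {x} {y} p q = Inverse.to (mult x y _ _ q) ((x , y) , refl , refl , p)

  singletons-isSubgroup : IsSubgroup Singleton
  singletons-isSubgroup = record
    { ε-closed  = λ y c → sym (e-basic y (sym c))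
    ; ∙-closed  = ∙-closed
    ; ⁻¹-closed = ⁻¹-closed
    }
    where
    ∙-closed : ∀ {x y} → Singleton x → Singleton y → Singleton (x ∙ y)
    ∙-closed {x} {y} sx sy z c with transfer {x} {y} refl c
    ... | (x′ , y′) , cx , cy , x′y′≡z = trans (cong₂ _∙_ (sx x′ (sym cx)) (sy y′ (sym cy))) x′y′≡z
    ⁻¹-closed : ∀ {x} → Singleton x → Singleton (x ⁻¹)
    ⁻¹-closed {x} sx y c =
      trans (cong _⁻¹ (sx (y ⁻¹) (subst (λ u → col u ≡ col (y ⁻¹)) (⁻¹-involutive x) (inv-basic (x ⁻¹) y c))))
            (⁻¹-involutive y)

  open IsSubgroup singletons-isSubgroup public
    renaming (ε-closed to singleton-ε; ∙-closed to singleton-∙; ⁻¹-closed to singleton-⁻¹)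

  singleton-≡ : ∀ {x y} → x ≡ y → Singleton x → Singleton y
  singleton-≡ refl s = s

  singleton-Gen : ∀ {P} → (∀ {x} → P x → Singleton x) → ∀ {x} → Gen k P x → Singleton x
  singleton-Gen = Gen-⊆ singletons-isSubgroup

  BasicUnion : (𝔾 → Set) → Set
  BasicUnion X = ∀ x y → col x ≡ col y → X x → X y

  _·ₗ_ : 𝔾 → (𝔾 → Set) → 𝔾 → Set
  (g ·ₗ X) z = Σ 𝔾 λ s → X s × g ∙ s ≡ z

  _·ᵣ_ : (𝔾 → Set) → 𝔾 → 𝔾 → Set
  (X ·ᵣ g) z = Σ 𝔾 λ s → X s × s ∙ g ≡ z

  basicUnion-·ₗ : ∀ {g X} → Singleton g → BasicUnion X → BasicUnion (g ·ₗ X)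
  basicUnion-·ₗ {g} sg X-union z z′ c (s , Xs , gs≡z) with transfer gs≡z c
  ... | (g′ , s′) , cg , cs , g′s′≡z′ =
    s′ , X-union s s′ (sym cs) Xs , trans (cong (_∙ s′) (sg g′ (sym cg))) g′s′≡z′

  basicUnion-·ᵣ : ∀ {g X} → Singleton g → BasicUnion X → BasicUnion (X ·ᵣ g)
  basicUnion-·ᵣ {g} sg X-union z z′ c (s , Xs , sg≡z) with transfer sg≡z c
  ... | (s′ , g′) , cs , cg , s′g′≡z′ =
    s′ , X-union s s′ (sym cs) Xs , trans (cong (s′ ∙_) (sg g′ (sym cg))) s′g′≡z′

  basicUnion-¬ : ∀ {X} → BasicUnion X → BasicUnion (λ z → ¬ X z)
  basicUnion-¬ X-union x y c ¬Xx Xy = ¬Xx (X-union y x (sym c) Xy)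

  record SameClass {z z′} (u : Factorisation z) (v : Factorisation z′) : Set where
    constructor sameClass
    field
      left-class  : col (left u) ≡ col (left v)
      right-class : col (right u) ≡ col (right v)

  sameClass? : ∀ {z z′} (u : Factorisation z) (v : Factorisation z′) → Dec (SameClass u v)
  sameClass? u v = map′ (λ (p , q) → sameClass p q) (λ (sameClass p q) → p , q)
                        (col (left u) ℕ.≟ col (left v) ×-dec col (right u) ℕ.≟ col (right v))

  sameClass-refl : ∀ {z} (u : Factorisation z) → SameClass u u
  sameClass-refl u = sameClass refl refl

  sameClass-sym : ∀ {z z′} {u : Factorisation z} {v : Factorisation z′} → SameClass u v → SameClass v u
  sameClass-sym (sameClass p q) = sameClass (sym p) (sym q)

  sameClass-trans : ∀ {z z′ z″} {u : Factorisation z} {v : Factorisation z′} {w : Factorisation z″} →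
                    SameClass u v → SameClass v w → SameClass u w
  sameClass-trans (sameClass p q) (sameClass p′ q′) = sameClass (trans p p′) (trans q q′)

  apart : ∀ {z z′} {v v′ : Factorisation z} {t t′ : Factorisation z′} →
          SameClass t v → SameClass t′ v′ → ¬ SameClass v v′ → proj₁ t ≢ proj₁ t′
  apart (sameClass l r) (sameClass l′ r′) ¬vv′ p =
    ¬vv′ (sameClass (trans (sym l) (trans (cong (col ∘ proj₁) p) l′)) (trans (sym r) (trans (cong (col ∘ proj₂) p) r′)))

  module Transport {z z′} (c : col z ≡ col z′) (r : Factorisation z) where
    bijection : Pairs k col (left r) (right r) z ↔ Pairs k col (left r) (right r) z′
    bijection = mult (left r) (right r) z z′ c

    as-pair : (v : Factorisation z) → SameClass v r → Pairs k col (left r) (right r) z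
    as-pair v (sameClass cl cr) = proj₁ v , cl , cr , factors v

    image : (v : Factorisation z) → SameClass v r → Pairs k col (left r) (right r) z′
    image v h = Inverse.to bijection (as-pair v h)

    transport : (v : Factorisation z) → SameClass v r → Factorisation z′
    transport v h =
      let ((x , y) , cx , cy , xy≡z′) = image v h in
      (x , y) , S-union (left v) x (trans (SameClass.left-class h) (sym cx)) (left∈S v)
              , S-union (right v) y (trans (SameClass.right-class h) (sym cy)) (right∈S v) , xy≡z′

    transport-class : ∀ v h → SameClass (transport v h) v
    transport-class v h@(sameClass cl cr) =
      sameClass (trans (proj₁ (proj₂ (image v h))) (sym cl)) (trans (proj₁ (proj₂ (proj₂ (image v h)))) (sym cr))

    transport-injective : ∀ v v′ h h′ → proj₁ (transport v h) ≡ proj₁ (transport v′ h′) → proj₁ v ≡ proj₁ v′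
    transport-injective v v′ h h′ p = cong proj₁ (begin
      as-pair v h                                        ≡⟨ Inverse.strictlyInverseʳ bijection (as-pair v h) ⟨
      Inverse.from bijection (image v h)                 ≡⟨ cong (Inverse.from bijection) (Pairs-≡ _ _ p) ⟩
      Inverse.from bijection (image v′ h′)               ≡⟨ Inverse.strictlyInverseʳ bijection (as-pair v′ h′) ⟩
      as-pair v′ h′                                      ∎)
      where open ≡-Reasoning

  module _ {z z′ : 𝔾} (c : col z ≡ col z′) (three : ThreeFactorisations z) where
    open ThreeFactorisations three
    private
      module T₁ = Transport c u₁
      module T₂ = Transport c u₂
      module T₃ = Transport c u₃
      r₁ = sameClass-refl u₁
      r₂ = sameClass-refl u₂
      r₃ = sameClass-refl u₃

    three-factorisations-transfer : ThreeFactorisations z′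
    three-factorisations-transfer with sameClass? u₂ u₁ | sameClass? u₃ u₁ | sameClass? u₃ u₂
    ... | yes h₂ | yes h₃ | _ = record
      { u₁ = T₁.transport u₁ r₁ ; u₂ = T₁.transport u₂ h₂ ; u₃ = T₁.transport u₃ h₃
      ; u₁≢u₂ = u₁≢u₂ ∘ T₁.transport-injective u₁ u₂ r₁ h₂
      ; u₁≢u₃ = u₁≢u₃ ∘ T₁.transport-injective u₁ u₃ r₁ h₃
      ; u₂≢u₃ = u₂≢u₃ ∘ T₁.transport-injective u₂ u₃ h₂ h₃ }
    ... | yes h₂ | no ¬h₃ | _ = record
      { u₁ = T₁.transport u₁ r₁ ; u₂ = T₁.transport u₂ h₂ ; u₃ = T₃.transport u₃ r₃
      ; u₁≢u₂ = u₁≢u₂ ∘ T₁.transport-injective u₁ u₂ r₁ h₂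
      ; u₁≢u₃ = apart (T₁.transport-class u₁ r₁) (T₃.transport-class u₃ r₃) (¬h₃ ∘ sameClass-sym)
      ; u₂≢u₃ = apart (T₁.transport-class u₂ h₂) (T₃.transport-class u₃ r₃)
                      (λ h → ¬h₃ (sameClass-trans (sameClass-sym h) h₂)) }
    ... | no ¬h₂ | yes h₃ | _ = record
      { u₁ = T₁.transport u₁ r₁ ; u₂ = T₂.transport u₂ r₂ ; u₃ = T₁.transport u₃ h₃
      ; u₁≢u₂ = apart (T₁.transport-class u₁ r₁) (T₂.transport-class u₂ r₂) (¬h₂ ∘ sameClass-sym)
      ; u₁≢u₃ = u₁≢u₃ ∘ T₁.transport-injective u₁ u₃ r₁ h₃
      ; u₂≢u₃ = apart (T₂.transport-class u₂ r₂) (T₁.transport-class u₃ h₃) (λ h → ¬h₂ (sameClass-trans h h₃)) }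
    ... | no ¬h₂ | no ¬h₃ | yes h₃₂ = record
      { u₁ = T₁.transport u₁ r₁ ; u₂ = T₂.transport u₂ r₂ ; u₃ = T₂.transport u₃ h₃₂
      ; u₁≢u₂ = apart (T₁.transport-class u₁ r₁) (T₂.transport-class u₂ r₂) (¬h₂ ∘ sameClass-sym)
      ; u₁≢u₃ = apart (T₁.transport-class u₁ r₁) (T₂.transport-class u₃ h₃₂) (¬h₃ ∘ sameClass-sym)
      ; u₂≢u₃ = u₂≢u₃ ∘ T₂.transport-injective u₂ u₃ r₂ h₃₂ }
    ... | no ¬h₂ | no ¬h₃ | no ¬h₃₂ = record
      { u₁ = T₁.transport u₁ r₁ ; u₂ = T₂.transport u₂ r₂ ; u₃ = T₃.transport u₃ r₃
      ; u₁≢u₂ = apart (T₁.transport-class u₁ r₁) (T₂.transport-class u₂ r₂) (¬h₂ ∘ sameClass-sym)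
      ; u₁≢u₃ = apart (T₁.transport-class u₁ r₁) (T₃.transport-class u₃ r₃) (¬h₃ ∘ sameClass-sym)
      ; u₂≢u₃ = apart (T₂.transport-class u₂ r₂) (T₃.transport-class u₃ r₃) (¬h₃₂ ∘ sameClass-sym) }

  cb-three-factorisations : ThreeFactorisations cb
  cb-three-factorisations = record
    { u₁ = (c k , b k) , c∈S , b∈S , refl
    ; u₂ = (b k , c k) , b∈S , c∈S , solve₀ (`b `∙ `c) (`c `∙ `b) refl
    ; u₃ = (ca , b k ∙ a k) , ca∈S , ba∈S , solve₀ ((`c `∙ `a) `∙ (`b `∙ `a)) (`c `∙ `b) refl
    ; u₁≢u₂ = λ p → C≢B (cong (π ∘ proj₁) p)
    ; u₁≢u₃ = λ p → a≢ε (sym (∙-cancelˡ (c k) ε (a k) (trans (∙-identityʳ (c k)) (cong proj₁ p))))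
    ; u₂≢u₃ = λ p → B≢C (cong (π ∘ proj₁) p)
    }
    where
    C≢B : C ≢ B
    C≢B ()
    B≢C : B ≢ C
    B≢C ()

  cb-singleton : Singleton cb
  cb-singleton y c with y ≟ cb
  ... | yes y≡cb = sym y≡cb
  ... | no  y≢cb = ⊥-elim (at-most-two-factorisations (S-union cb y c cb∈S) y≢cb
                            (three-factorisations-transfer c cb-three-factorisations))

  S-avoids-bits : ∀ {s t} → ¬ πS t → π s ≡ t → ¬ S k s
  S-avoids-bits ¬t p Ss = ¬t (subst πS p (π-S Ss))

  bits-of-left-factor : ∀ s {z} → s ∙ cb ≡ z → π s ≡ π z ⊕ BC
  bits-of-left-factor s {z} p = ⊕-solveˡ {π s} {BC} {π z} (cong π p)

  bits-of-right-factor : ∀ s {z} → cb ∙ s ≡ z → π s ≡ BC ⊕ π z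
  bits-of-right-factor s {z} p = ⊕-solveʳ {BC} {π s} {π z} (cong π p)

  cb·S⊇bA : ∀ {t} → A k t → (cb ·ₗ S k) (b k ∙ t)
  cb·S⊇bA At = _ , cA⊆S At , solveA At ((`c `∙ `b) `∙ (`c `∙ `v)) (`b `∙ `v) refl
    where
    cA⊆S : ∀ {t} → A k t → S k (c k ∙ t)
    cA⊆S At = inj₂ (inj₁ (_ , At , refl))

  cb·S⊇cA : ∀ {t} → A k t → t ≢ a k ⁻¹ → (cb ·ₗ S k) (c k ∙ t)
  cb·S⊇cA At t≢a⁻¹ = _ , inj₁ (_ , At , t≢a⁻¹ , refl) , solveA At ((`c `∙ `b) `∙ (`b `∙ `v)) (`c `∙ `v) refl

  S∖cb·S : ∀ {y} → S k y → ¬ (cb ·ₗ S k) y → y ≡ ca ⁻¹ ⊎ y ≡ cb ⊎ y ≡ db ⊎ y ≡ dcba⁻¹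
  S∖cb·S (inj₁ (t , At , _ , refl))          ∉ = ⊥-elim (∉ (cb·S⊇bA At))
  S∖cb·S (inj₂ (inj₁ (t , At , refl)))       ∉ with t ≟ a k ⁻¹
  ... | yes refl    = inj₁ (solve₀ (`c `∙ `a `⁻¹) ((`c `∙ `a) `⁻¹) refl)
  ... | no  t≢a⁻¹   = ⊥-elim (∉ (cb·S⊇cA At t≢a⁻¹))
  S∖cb·S (inj₂ (inj₂ (inj₁ refl)))           _ = inj₂ (inj₁ refl)
  S∖cb·S (inj₂ (inj₂ (inj₂ (inj₁ refl))))    _ = inj₂ (inj₂ (inj₁ refl))
  S∖cb·S (inj₂ (inj₂ (inj₂ (inj₂ refl))))    _ = inj₂ (inj₂ (inj₂ refl))

  ca⁻¹∉cb·S : ¬ (cb ·ₗ S k) (ca ⁻¹)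
  ca⁻¹∉cb·S (s , Ss , cbs≡ca⁻¹) with S-B Ss (bits-of-right-factor s cbs≡ca⁻¹)
  ... | t , At , t≢a⁻¹ , refl = t≢a⁻¹ (∙-cancelˡ (c k) _ _ (begin
    c k ∙ t             ≡⟨ solveA At ((`c `∙ `b) `∙ (`b `∙ `v)) (`c `∙ `v) refl ⟨
    cb ∙ (b k ∙ t)      ≡⟨ cbs≡ca⁻¹ ⟩
    ca ⁻¹               ≡⟨ solve₀ ((`c `∙ `a) `⁻¹) (`c `∙ `a `⁻¹) refl ⟩
    c k ∙ a k ⁻¹        ∎))
    where open ≡-Reasoning

  ca⁻¹∈S·cb : (S k ·ᵣ cb) (ca ⁻¹)
  ca⁻¹∈S·cb = _ , ba∈S , solve₀ ((`b `∙ `a) `∙ (`c `∙ `b)) ((`c `∙ `a) `⁻¹) refl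

  cb∉S·cb : ¬ (S k ·ᵣ cb) cb
  cb∉S·cb (s , Ss , p) = S-avoids-bits (λ ()) (bits-of-left-factor s p) Ss

  db∉S·cb : ¬ (S k ·ᵣ cb) db
  db∉S·cb (s , Ss , p) = S-avoids-bits (λ ()) (bits-of-left-factor s p) Ss

  dcba⁻¹∉S·cb : ¬ (S k ·ᵣ cb) dcba⁻¹
  dcba⁻¹∉S·cb (s , Ss , p) = S-avoids-bits (λ ()) (bits-of-left-factor s p) Ss

  db∉cb·S : ¬ (cb ·ₗ S k) db
  db∉cb·S (s , Ss , p) = S-avoids-bits (λ ()) (bits-of-right-factor s p) Ss

  dcba⁻¹∉cb·S : ¬ (cb ·ₗ S k) dcba⁻¹
  dcba⁻¹∉cb·S (s , Ss , p) = S-avoids-bits (λ ()) (bits-of-right-factor s p) Ss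

  -- ca⁻¹ is the only element of S outside cb·S that lies in S·cb.
  ca⁻¹-singleton : Singleton (ca ⁻¹)
  ca⁻¹-singleton y c =
    only-candidate (S∖cb·S (S-union _ y c ca⁻¹∈S)
                           (basicUnion-¬ (basicUnion-·ₗ cb-singleton S-union) _ y c ca⁻¹∉cb·S))
                   (basicUnion-·ᵣ cb-singleton S-union _ y c ca⁻¹∈S·cb)
    where
    only-candidate : y ≡ ca ⁻¹ ⊎ y ≡ cb ⊎ y ≡ db ⊎ y ≡ dcba⁻¹ → (S k ·ᵣ cb) y → ca ⁻¹ ≡ y
    only-candidate (inj₁ y≡ca⁻¹)          _ = sym y≡ca⁻¹
    only-candidate (inj₂ (inj₁ refl))        y∈ = ⊥-elim (cb∉S·cb y∈)
    only-candidate (inj₂ (inj₂ (inj₁ refl))) y∈ = ⊥-elim (db∉S·cb y∈)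
    only-candidate (inj₂ (inj₂ (inj₂ refl))) y∈ = ⊥-elim (dcba⁻¹∉S·cb y∈)

  ca-singleton : Singleton ca
  ca-singleton = singleton-≡ (⁻¹-involutive ca) (singleton-⁻¹ ca⁻¹-singleton)

  db·ca≢dcba⁻¹ : db ∙ ca ≢ dcba⁻¹
  db·ca≢dcba⁻¹ p =
    1≉neg1 (trans (sym (Evaluation.≡⇒value-≈ ε refl {`d `∙ `b `∙ (`c `∙ `a)} {`d `∙ `c `∙ `b `∙ `a `⁻¹} p))
                  (≈-reflexive (+-identityʳ (neg 1))))

  Residual : 𝔾 → Set
  Residual z = S k z × ¬ (cb ·ₗ S k) z × ¬ (S k ·ᵣ cb) z × col z ≢ col cb

  basicUnion-Residual : BasicUnion Residual
  basicUnion-Residual x y c (Sx , x∉cb·S , x∉S·cb , x≁cb) =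
    S-union x y c Sx , basicUnion-¬ (basicUnion-·ₗ cb-singleton S-union) x y c x∉cb·S ,
    basicUnion-¬ (basicUnion-·ᵣ cb-singleton S-union) x y c x∉S·cb , (λ p → x≁cb (trans c p))

  Residual⊆ : ∀ {y} → Residual y → y ≡ db ⊎ y ≡ dcba⁻¹
  Residual⊆ (Sy , y∉cb·S , y∉S·cb , y≁cb) with S∖cb·S Sy y∉cb·S
  ... | inj₁ refl               = ⊥-elim (y∉S·cb ca⁻¹∈S·cb)
  ... | inj₂ (inj₁ refl)        = ⊥-elim (y≁cb refl)
  ... | inj₂ (inj₂ (inj₁ y≡db)) = inj₁ y≡db
  ... | inj₂ (inj₂ (inj₂ y≡q))  = inj₂ y≡q

  db∈Residual : Residual db
  db∈Residual = db∈S , db∉cb·S , db∉S·cb , λ p → BC≢BD (cong π (cb-singleton db (sym p)))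
    where
    BC≢BD : BC ≢ BD
    BC≢BD ()

  dcba⁻¹∈Residual : Residual dcba⁻¹
  dcba⁻¹∈Residual =
    dcba⁻¹∈S , dcba⁻¹∉cb·S , dcba⁻¹∉S·cb , λ p → BC≢BCD (cong π (cb-singleton dcba⁻¹ (sym p)))
    where
    BC≢BCD : BC ≢ BCD
    BC≢BCD ()

  -- Residual = {db, dcba⁻¹}, and right multiplication by the singleton ca maps dcba⁻¹ to db but not back.
  db-singleton : Singleton db
  db-singleton y c = only-candidate (Residual⊆ (basicUnion-Residual db y c db∈Residual))
    (basicUnion-·ᵣ ca-singleton basicUnion-Residual db y c
      (dcba⁻¹ , dcba⁻¹∈Residual , solve₀ ((`d `∙ `c `∙ `b `∙ `a `⁻¹) `∙ (`c `∙ `a)) (`d `∙ `b) refl))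
    where
    only-candidate : y ≡ db ⊎ y ≡ dcba⁻¹ → (Residual ·ᵣ ca) y → db ≡ y
    only-candidate (inj₁ y≡db) _ = sym y≡db
    only-candidate (inj₂ refl) (s , Residual-s , s·ca≡dcba⁻¹) with Residual⊆ Residual-s
    ... | inj₁ refl = ⊥-elim (db·ca≢dcba⁻¹ s·ca≡dcba⁻¹)
    ... | inj₂ refl = ⊥-elim (C≢O (cong π (∙-cancelˡ dcba⁻¹ ca ε (trans s·ca≡dcba⁻¹ (sym (∙-identityʳ dcba⁻¹))))))
      where
      C≢O : C ≢ O
      C≢O ()

  aPow2-singleton : Singleton (aPow 2)
  aPow2-singleton = singleton-≡ (trans (solve₀ ((`c `∙ `a) `∙ (`c `∙ `a)) (`a `∙ `a) refl) (aPow-+ 1 1))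
                                (singleton-∙ ca-singleton ca-singleton)

module OddCase (k : ℕ) .{{_ : NonZero k}} (k≥3 : 3 ≤ k) (k-odd : ¬ (2 ∣ k))
               (col : G k → ℕ) (isSRing : IsSRing k col) (S-union : SUnion k col) where
  open SchurRing k k≥3 col isSRing S-union

  -- a = (a²)^((k+1)/2)
  a-singleton : Singleton (a k)
  a-singleton with odd⇒1+2r k-odd
  ... | r , k≡1+2r = singleton-≡ (aPow-cong (trans (cong (λ n → suc n % k) (sym k≡1+2r)) ([m+n]%n≡m%n 1 k)))
                                 (aPow-closed singletons-isSubgroup aPow2-singleton (suc r))

  c-singleton : Singleton (c k)
  c-singleton = singleton-≡ (solve₀ ((`c `∙ `a) `∙ `a `⁻¹) `c refl) (singleton-∙ ca-singleton (singleton-⁻¹ a-singleton))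

  b-singleton : Singleton (b k)
  b-singleton = singleton-≡ (solve₀ (`c `∙ (`c `∙ `b)) `b refl) (singleton-∙ c-singleton cb-singleton)

  d-singleton : Singleton (d k)
  d-singleton = singleton-≡ (solve₀ ((`d `∙ `b) `∙ `b) `d refl) (singleton-∙ db-singleton b-singleton)

  discrete : ∀ x → Singleton x
  discrete = generated-by-abcd singletons-isSubgroup a-singleton b-singleton c-singleton d-singleton

module EvenCase (k : ℕ) .{{_ : NonZero k}} (k≥3 : 3 ≤ k) (r : ℕ) (k≡r*2 : k ≡ r * 2) where
  open ConnectionSet k k≥3

  odd-% : ∀ n → odd (n % k) ≡ odd n
  odd-% n = sym (begin
    odd n                               ≡⟨ cong odd (m≡m%n+[m/n]*n n k) ⟩
    odd (n % k + n / k * k)             ≡⟨ odd-+ (n % k) _ ⟩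
    odd (n % k) xor odd (n / k * k)     ≡⟨ cong (λ m → odd (n % k) xor odd m)
                                                 (trans (cong (n / k *_) k≡r*2) (sym (*-assoc (n / k) r 2))) ⟩
    odd (n % k) xor odd (n / k * r * 2) ≡⟨ cong (odd (n % k) xor_) (odd-*2 (n / k * r)) ⟩
    odd (n % k) xor false               ≡⟨ xor-identityʳ _ ⟩
    odd (n % k)                         ∎)
    where open ≡-Reasoning

  odd-≈ : ∀ {m n} → m ≈ n → odd m ≡ odd n
  odd-≈ {m} {n} p = trans (sym (odd-% m)) (trans (cong odd p) (odd-% n))

  odd-neg : ∀ n → odd (neg n) ≡ odd n
  odd-neg n = trans (xor≡false⇒≡ (odd (neg n)) (odd (n % k)) (begin
    odd (neg n) xor odd (n % k)   ≡⟨ odd-+ (neg n) (n % k) ⟨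
    odd (neg n + n % k)           ≡⟨ cong odd (m∸n+n≡m (m%n≤n n k)) ⟩
    odd k                         ≡⟨ trans (cong odd k≡r*2) (odd-*2 r) ⟩
    false                         ∎)) (odd-% n)
    where open ≡-Reasoning

  odd-negIf : ∀ j n → odd (negIf j n) ≡ odd n
  odd-negIf false n = refl
  odd-negIf true  n = odd-neg n

  par : 𝔾 → Bool
  par x = odd (expA x)

  par-∙ : ∀ x y → par (x ∙ y) ≡ par x xor par y
  par-∙ x y = trans (odd-≈ (expA-∙ x y)) (trans (odd-+ (expA x) _) (cong (par x xor_) (odd-negIf (G.eb x) (expA y))))

  par-⁻¹ : ∀ x → par (x ⁻¹) ≡ par x
  par-⁻¹ x = trans (odd-≈ (expA-⁻¹ x)) (odd-negIf (not (G.eb x)) (expA x))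

  -- The projection G → G/L ≅ Z₂³; U is the preimage of the even-weight vectors.
  ℓ : 𝔾 → Bits
  ℓ x = par x , G.eb x xor G.ec x , G.ed x

  ℓ-∙ : ∀ x y → ℓ (x ∙ y) ≡ ℓ x ⊕ ℓ y
  ℓ-∙ x y = cong₂ _,_ (par-∙ x y) (cong (_, G.ed x xor G.ed y) (xor-interchange (G.eb x) (G.eb y) (G.ec x) (G.ec y)))

  ℓ-⁻¹ : ∀ x → ℓ (x ⁻¹) ≡ ℓ x
  ℓ-⁻¹ x = cong (_, G.eb x xor G.ec x , G.ed x) (par-⁻¹ x)

  ℓ-ε : ℓ ε ≡ O
  ℓ-ε = cong (λ n → odd n , false , false) expA-ε

  ℓ-isSubgroup : IsSubgroup (λ x → ℓ x ≡ O)
  ℓ-isSubgroup = kernel-isSubgroup ℓ ℓ-ε ℓ-∙ ℓ-⁻¹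

  χ : 𝔾 → Bool
  χ x = weight (ℓ x)

  χ-∙ : ∀ x y → χ (x ∙ y) ≡ χ x xor χ y
  χ-∙ x y = trans (cong weight (ℓ-∙ x y)) (weight-⊕ (ℓ x) (ℓ y))

  χ-isSubgroup : IsSubgroup (λ x → χ x ≡ false)
  χ-isSubgroup = record
    { ε-closed  = cong weight ℓ-ε
    ; ∙-closed  = λ {x} {y} p q → trans (χ-∙ x y) (cong₂ _xor_ p q)
    ; ⁻¹-closed = λ {x} p → trans (cong weight (ℓ-⁻¹ x)) p
    }

  ℓ̂ : Word → Bits
  ℓ̂ `a        = B
  ℓ̂ `b        = C
  ℓ̂ `c        = C
  ℓ̂ `d        = D
  ℓ̂ `e        = O
  ℓ̂ `v        = O
  ℓ̂ (x `∙ y)  = ℓ̂ x ⊕ ℓ̂ y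
  ℓ̂ (x `⁻¹)   = ℓ̂ x

  ℓ-word : ∀ w → ℓ (⟦ w ⟧ ε) ≡ ℓ̂ w
  ℓ-word `a        = cong (λ n → odd n , false , false) (trans (toℕ-mod 1) (m<n⇒m%n≡m 1<k))
  ℓ-word `b        = cong (λ n → odd n , true , false) expA-ε
  ℓ-word `c        = cong (λ n → odd n , true , false) expA-ε
  ℓ-word `d        = cong (λ n → odd n , false , true) expA-ε
  ℓ-word `e        = ℓ-ε
  ℓ-word `v        = ℓ-ε
  ℓ-word (x `∙ y)  = trans (ℓ-∙ (⟦ x ⟧ ε) (⟦ y ⟧ ε)) (cong₂ _⊕_ (ℓ-word x) (ℓ-word y))
  ℓ-word (x `⁻¹)   = trans (ℓ-⁻¹ (⟦ x ⟧ ε)) (ℓ-word x)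

  A₁-intro : ∀ {y} → π y ≡ O → par y ≡ false → A₁ k y
  A₁-intro {y} πy pary with even⇒*2 (expA y) pary
  ... | h , expA≡2h = subst (A₁ k) (sym (trans (aPow-expA πy) (cong aPow expA≡2h)))
                            (aPow-closed Gen-isSubgroup (subst (A₁ k) (aPow-+ 1 1) (gen-in refl)) h)

  cbPow : Bool → 𝔾
  cbPow false = ε
  cbPow true  = cb

  cbPow∈⟨cb⟩ : ∀ j → Gen k (λ w → w ≡ c k ∙ b k) (cbPow j)
  cbPow∈⟨cb⟩ false = gen-e
  cbPow∈⟨cb⟩ true  = gen-in refl

  par-cbPow : ∀ j → par (cbPow j) ≡ false
  par-cbPow false = cong proj₁ ℓ-ε
  par-cbPow true  = cong proj₁ (ℓ-word (`c `∙ `b))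

  L⇒ℓ≡O : ∀ {x} → L k x → ℓ x ≡ O
  L⇒ℓ≡O (y , z , A₁y , ⟨cb⟩z , refl) =
    trans (ℓ-∙ y z) (cong₂ _⊕_ (Gen-⊆ ℓ-isSubgroup (λ { refl → ℓ-word (`a `∙ `a) }) A₁y)
                              (Gen-⊆ ℓ-isSubgroup (λ { refl → ℓ-word (`c `∙ `b) }) ⟨cb⟩z))

  ℓ≡O⇒L : ∀ {x} → ℓ x ≡ O → L k x
  ℓ≡O⇒L {x} ℓx≡O = x ∙ z ⁻¹ , z , A₁-intro πy pary , cbPow∈⟨cb⟩ j , sym (//-rightDividesˡ z x)
    where
    j = G.eb x
    z = cbPow j
    πx : π x ≡ (j , j , false)
    πx = cong₂ _,_ refl (cong₂ _,_ (sym (xor≡false⇒≡ j (G.ec x) (cong (proj₁ ∘ proj₂) ℓx≡O)))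
                                   (cong (proj₂ ∘ proj₂) ℓx≡O))
    π-cbPow : ∀ j → π (cbPow j) ≡ (j , j , false)
    π-cbPow false = refl
    π-cbPow true  = refl
    πy : π (x ∙ z ⁻¹) ≡ O
    πy = trans (cong₂ _⊕_ πx (π-cbPow j)) (⊕-self (j , j , false))
    pary : par (x ∙ z ⁻¹) ≡ false
    pary = trans (par-∙ x (z ⁻¹)) (cong₂ _xor_ (cong proj₁ ℓx≡O) (trans (par-⁻¹ z) (par-cbPow j)))

  U⇒χ≡false : ∀ {x} → U k x → χ x ≡ false
  U⇒χ≡false = Gen-⊆ χ-isSubgroup generators
    where
    generators : ∀ {x} → L k x ⊎ x ≡ c k ∙ a k ⊎ x ≡ d k ∙ a k → χ x ≡ false
    generators (inj₁ Lx)          = cong weight (L⇒ℓ≡O Lx)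
    generators (inj₂ (inj₁ refl)) = cong weight (ℓ-word (`c `∙ `a))
    generators (inj₂ (inj₂ refl)) = cong weight (ℓ-word (`d `∙ `a))

  U-representative : ∀ v → weight v ≡ false → Σ 𝔾 λ g → U k g × ℓ g ≡ v
  U-representative O   _ = ε , gen-e , ℓ-ε
  U-representative BC  _ = ca , gen-in (inj₂ (inj₁ refl)) , ℓ-word (`c `∙ `a)
  U-representative BD  _ = d k ∙ a k , gen-in (inj₂ (inj₂ refl)) , ℓ-word (`d `∙ `a)
  U-representative CD  _ = ca ∙ (d k ∙ a k) , gen-mul (gen-in (inj₂ (inj₁ refl))) (gen-in (inj₂ (inj₂ refl))) ,
                           ℓ-word (`c `∙ `a `∙ (`d `∙ `a))
  U-representative B   ()
  U-representative C   ()
  U-representative D   ()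
  U-representative BCD ()

  χ≡false⇒U : ∀ {x} → χ x ≡ false → U k x
  χ≡false⇒U {x} χx with U-representative (ℓ x) χx
  ... | g , Ug , ℓg = subst (U k) (//-rightDividesˡ g x) (gen-mul (gen-in (inj₁ (ℓ≡O⇒L {x ∙ g ⁻¹} ℓ-quotient))) Ug)
    where
    ℓ-quotient : ℓ (x ∙ g ⁻¹) ≡ O
    ℓ-quotient = trans (ℓ-∙ x (g ⁻¹)) (trans (cong (ℓ x ⊕_) (trans (ℓ-⁻¹ g) ℓg)) (⊕-self (ℓ x)))

  flexible-coset : ∀ (p : Bool) (t : Bits) → t ≡ B ⊎ t ≡ C →
                   weight (p , proj₁ t xor proj₁ (proj₂ t) , proj₂ (proj₂ t)) ≡ true →
                   (p , proj₁ t xor proj₁ (proj₂ t) , proj₂ (proj₂ t)) ≡ C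
  flexible-coset false _ (inj₁ refl) _  = refl
  flexible-coset false _ (inj₂ refl) _  = refl
  flexible-coset true  _ (inj₁ refl) ()
  flexible-coset true  _ (inj₂ refl) ()

  flexible-bits : ∀ (t : Bits) → proj₁ t xor proj₁ (proj₂ t) ≡ true → proj₂ (proj₂ t) ≡ false → t ≡ B ⊎ t ≡ C
  flexible-bits (true  , false , false) _  _  = inj₁ refl
  flexible-bits (false , true  , false) _  _  = inj₂ refl
  flexible-bits (true  , true  , _)     () _
  flexible-bits (false , false , _)     () _
  flexible-bits (_     , _     , true)  _  ()

  false≢true : false ≢ true
  false≢true ()

  S∖U-coset : ∀ {s} → S k s → χ s ≡ true → ℓ s ≡ C
  S∖U-coset (inj₁ (t , At , _ , refl))       = flexible-coset (par (b k ∙ t)) _ (inj₁ (π-bA At))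
  S∖U-coset (inj₂ (inj₁ (t , At , refl)))    = flexible-coset (par (c k ∙ t)) _ (inj₂ (π-cA At))
  S∖U-coset (inj₂ (inj₂ (inj₁ refl)))        =
    λ χ≡true → ⊥-elim (false≢true (trans (sym (cong weight (ℓ-word (`c `∙ `b)))) χ≡true))
  S∖U-coset (inj₂ (inj₂ (inj₂ (inj₁ refl)))) =
    λ χ≡true → ⊥-elim (false≢true (trans (sym (cong weight (ℓ-word (`d `∙ `b)))) χ≡true))
  S∖U-coset (inj₂ (inj₂ (inj₂ (inj₂ refl)))) =
    λ χ≡true → ⊥-elim (false≢true (trans (sym (cong weight (ℓ-word (`d `∙ `c `∙ `b `∙ `a `⁻¹)))) χ≡true))

  ℓ≡C⇒S : ∀ {y} → ℓ y ≡ C → S k y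
  ℓ≡C⇒S {y} ℓy≡C with flexible-bits (π y) (cong (proj₁ ∘ proj₂) ℓy≡C) (cong (proj₂ ∘ proj₂) ℓy≡C)
  ... | inj₁ πy≡B = inj₁ (b k ⁻¹ ∙ y , A-intro (cong (B ⊕_) πy≡B) , t≢a⁻¹ , sym (\\-leftDividesˡ (b k) y))
    where
    t≢a⁻¹ : b k ⁻¹ ∙ y ≢ a k ⁻¹
    t≢a⁻¹ p = false≢true (begin
      false                   ≡⟨ cong₂ _xor_ (cong proj₁ (ℓ-word (`b `⁻¹))) (cong proj₁ ℓy≡C) ⟨
      par (b k ⁻¹) xor par y  ≡⟨ par-∙ (b k ⁻¹) y ⟨
      par (b k ⁻¹ ∙ y)        ≡⟨ cong par p ⟩
      par (a k ⁻¹)            ≡⟨ cong proj₁ (ℓ-word (`a `⁻¹)) ⟩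
      true                    ∎)
      where open ≡-Reasoning
  ... | inj₂ πy≡C = inj₂ (inj₁ (c k ⁻¹ ∙ y , A-intro (cong (C ⊕_) πy≡C) , sym (\\-leftDividesˡ (c k) y)))

  Coset : 𝔾 → 𝔾 → Set
  Coset x y = χ x ≡ true × χ y ≡ true × ℓ x ≡ ℓ y

  ¬U⇔χ≡true : ∀ {x} → (¬ U k x) ⇔ χ x ≡ true
  ¬U⇔χ≡true {x} = mk⇔ (λ ¬Ux → ¬false (λ χx → ¬Ux (χ≡false⇒U χx)))
                      (λ χx Ux → false≢true (trans (sym (U⇒χ≡false Ux)) χx))
    where
    ¬false : ∀ {p} → p ≢ false → p ≡ true
    ¬false {false} p≢ = ⊥-elim (p≢ refl)
    ¬false {true}  _  = refl

  L-quotient⇔ : ∀ {x y} → L k (x ∙ y ⁻¹) ⇔ ℓ x ≡ ℓ y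
  L-quotient⇔ {x} {y} = mk⇔
    (λ L-xy⁻¹ → ⊕-solveˡ {ℓ x} {ℓ y} {O}
                  (trans (cong (ℓ x ⊕_) (sym (ℓ-⁻¹ y))) (trans (sym (ℓ-∙ x (y ⁻¹))) (L⇒ℓ≡O L-xy⁻¹))))
    (λ ℓx≡ℓy → ℓ≡O⇒L (trans (ℓ-∙ x (y ⁻¹)) (trans (cong₂ _⊕_ ℓx≡ℓy (ℓ-⁻¹ y)) (⊕-self (ℓ y)))))

  WreathRel⇔ : ∀ {x y} → WreathRel k x y ⇔ (x ≡ y ⊎ Coset x y)
  WreathRel⇔ {x} {y} = mk⇔
    (Data.Sum.map₂ λ (¬Ux , ¬Uy , L-xy⁻¹) →
      to (¬U⇔χ≡true {x}) ¬Ux , to (¬U⇔χ≡true {y}) ¬Uy , to (L-quotient⇔ {x} {y}) L-xy⁻¹)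
    (Data.Sum.map₂ λ (χx , χy , ℓx≡ℓy) →
      from (¬U⇔χ≡true {x}) χx , from (¬U⇔χ≡true {y}) χy , from (L-quotient⇔ {x} {y}) ℓx≡ℓy)
    where open Equivalence

  coset-of-ℓ : ∀ x y → χ y ≡ true → ℓ x ≡ ℓ y → Coset x y
  coset-of-ℓ _ _ χy ℓx≡ℓy = trans (cong weight ℓx≡ℓy) χy , χy , ℓx≡ℓy

  -- Left multiplication by l ∈ L applied to whichever factor lies outside U, so that classes are preserved.
  shift′ : Bool → 𝔾 → 𝔾 → 𝔾 → 𝔾 × 𝔾
  shift′ true  l x y = l ∙ x , y
  shift′ false l x y = x , x ⁻¹ ∙ (l ∙ x ∙ y)

  shift : 𝔾 → 𝔾 × 𝔾 → 𝔾 × 𝔾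
  shift l (x , y) = shift′ (χ x) l x y

  shift-product : ∀ l p → proj₁ (shift l p) ∙ proj₂ (shift l p) ≡ l ∙ (proj₁ p ∙ proj₂ p)
  shift-product l (x , y) = product (χ x)
    where
    product : ∀ j → proj₁ (shift′ j l x y) ∙ proj₂ (shift′ j l x y) ≡ l ∙ (x ∙ y)
    product true  = ∙-assoc l x y
    product false = trans (\\-leftDividesˡ x (l ∙ x ∙ y)) (∙-assoc l x y)

  shift-cosets : ∀ {l} → ℓ l ≡ O → ∀ p → χ (proj₁ p ∙ proj₂ p) ≡ true →
                 (proj₁ (shift l p) ≡ proj₁ p ⊎ Coset (proj₁ (shift l p)) (proj₁ p)) ×
                 (proj₂ (shift l p) ≡ proj₂ p ⊎ Coset (proj₂ (shift l p)) (proj₂ p))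
  shift-cosets {l} ℓl (x , y) χxy = cosets (χ x) refl
    where
    cosets : ∀ j → χ x ≡ j → (proj₁ (shift′ j l x y) ≡ x ⊎ Coset (proj₁ (shift′ j l x y)) x) ×
                             (proj₂ (shift′ j l x y) ≡ y ⊎ Coset (proj₂ (shift′ j l x y)) y)
    cosets true  χx = inj₂ (coset-of-ℓ (l ∙ x) x χx (trans (ℓ-∙ l x) (cong (_⊕ ℓ x) ℓl))) , inj₁ refl
    cosets false χx = inj₁ refl , inj₂ (coset-of-ℓ (x ⁻¹ ∙ (l ∙ x ∙ y)) y χy (begin
      ℓ (x ⁻¹ ∙ (l ∙ x ∙ y))            ≡⟨ ℓ-∙ (x ⁻¹) _ ⟩
      ℓ (x ⁻¹) ⊕ ℓ (l ∙ x ∙ y)          ≡⟨ cong₂ _⊕_ (ℓ-⁻¹ x) (ℓ-∙ (l ∙ x) y) ⟩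
      ℓ x ⊕ (ℓ (l ∙ x) ⊕ ℓ y)           ≡⟨ cong (λ t → ℓ x ⊕ (t ⊕ ℓ y)) (trans (ℓ-∙ l x) (cong (_⊕ ℓ x) ℓl)) ⟩
      ℓ x ⊕ (ℓ x ⊕ ℓ y)                 ≡⟨ ⊕-cancelˡ (ℓ x) (ℓ y) ⟩
      ℓ y                               ∎))
      where
      open ≡-Reasoning
      χy : χ y ≡ true
      χy = trans (sym (trans (χ-∙ x y) (cong (_xor χ y) χx))) χxy

  shift-involutive : ∀ {l} → χ l ≡ false → ∀ p → shift (l ⁻¹) (shift l p) ≡ p
  shift-involutive {l} χl (x , y) = back (χ x) refl
    where
    open ≡-Reasoning
    back : ∀ j → χ x ≡ j → shift (l ⁻¹) (shift′ j l x y) ≡ (x , y)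
    back true χx = begin
      shift′ (χ (l ∙ x)) (l ⁻¹) (l ∙ x) y  ≡⟨ cong (λ j → shift′ j (l ⁻¹) (l ∙ x) y) χlx ⟩
      (l ⁻¹ ∙ (l ∙ x) , y)                 ≡⟨ cong (_, y) (\\-leftDividesʳ l x) ⟩
      (x , y)                              ∎
      where
      χlx : χ (l ∙ x) ≡ true
      χlx = trans (χ-∙ l x) (cong₂ _xor_ χl χx)
    back false χx = begin
      shift′ (χ x) (l ⁻¹) x y′         ≡⟨ cong (λ j → shift′ j (l ⁻¹) x y′) χx ⟩
      (x , x ⁻¹ ∙ (l ⁻¹ ∙ x ∙ y′))     ≡⟨ cong (x ,_) restore ⟩
      (x , y)                          ∎
      where
      y′ = x ⁻¹ ∙ (l ∙ x ∙ y)
      restore : x ⁻¹ ∙ (l ⁻¹ ∙ x ∙ y′) ≡ y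
      restore = begin
        x ⁻¹ ∙ (l ⁻¹ ∙ x ∙ y′)         ≡⟨ cong (x ⁻¹ ∙_) (∙-assoc (l ⁻¹) x y′) ⟩
        x ⁻¹ ∙ (l ⁻¹ ∙ (x ∙ y′))       ≡⟨ cong (λ w → x ⁻¹ ∙ (l ⁻¹ ∙ w)) (\\-leftDividesˡ x (l ∙ x ∙ y)) ⟩
        x ⁻¹ ∙ (l ⁻¹ ∙ (l ∙ x ∙ y))    ≡⟨ cong (λ w → x ⁻¹ ∙ (l ⁻¹ ∙ w)) (∙-assoc l x y) ⟩
        x ⁻¹ ∙ (l ⁻¹ ∙ (l ∙ (x ∙ y)))  ≡⟨ cong (x ⁻¹ ∙_) (\\-leftDividesʳ l (x ∙ y)) ⟩
        x ⁻¹ ∙ (x ∙ y)                 ≡⟨ \\-leftDividesʳ x y ⟩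
        y                              ∎

  module CosetPartition (col : 𝔾 → ℕ) (fibres : ∀ x y → (col x ≡ col y) ⇔ (x ≡ y ⊎ Coset x y)) where

    same-class : ∀ {x y} → x ≡ y ⊎ Coset x y → col x ≡ col y
    same-class = Equivalence.from (fibres _ _)

    classes : ∀ {x y} → col x ≡ col y → x ≡ y ⊎ Coset x y
    classes = Equivalence.to (fibres _ _)

    move : ∀ {x₀ y₀ w w′} (m : 𝔾) → ℓ m ≡ O → χ w ≡ true → m ∙ w ≡ w′ →
           Pairs k col x₀ y₀ w → Pairs k col x₀ y₀ w′
    move m ℓm χw mw≡w′ (p , cx , cy , pw) =
      shift m p , trans (same-class (proj₁ cosets)) cx , trans (same-class (proj₂ cosets)) cy ,
      trans (shift-product m p) (trans (cong (m ∙_) pw) mw≡w′)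
      where
      cosets = shift-cosets ℓm p (trans (cong χ pw) χw)

    coset-bijection : ∀ {x₀ y₀ z z′} → Coset z z′ → Pairs k col x₀ y₀ z ↔ Pairs k col x₀ y₀ z′
    coset-bijection {z = z} {z′} (χz , χz′ , ℓz≡ℓz′) =
      mk↔ₛ′ (move l ℓl χz (//-rightDividesˡ z z′))
            (move (l ⁻¹) ℓl⁻¹ χz′ (trans (cong (l ⁻¹ ∙_) (sym (//-rightDividesˡ z z′))) (\\-leftDividesʳ l z)))
            (λ P → Pairs-≡ _ _ (subst (λ m → shift m (shift (l ⁻¹) (proj₁ P)) ≡ proj₁ P) (⁻¹-involutive l)
                                      (shift-involutive (cong weight ℓl⁻¹) (proj₁ P))))
            (λ P → Pairs-≡ _ _ (shift-involutive (cong weight ℓl) (proj₁ P)))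
      where
      l = z′ ∙ z ⁻¹
      ℓl : ℓ l ≡ O
      ℓl = trans (ℓ-∙ z′ (z ⁻¹)) (trans (cong₂ _⊕_ (sym ℓz≡ℓz′) (ℓ-⁻¹ z)) (⊕-self (ℓ z)))
      ℓl⁻¹ : ℓ (l ⁻¹) ≡ O
      ℓl⁻¹ = trans (ℓ-⁻¹ l) ℓl

    isSRing : IsSRing k col
    isSRing = record { e-basic = e-basic ; inv-basic = inv-basic ; mult = mult }
      where
      e-basic : ∀ x → col x ≡ col ε → x ≡ ε
      e-basic x c with classes c
      ... | inj₁ x≡ε              = x≡ε
      ... | inj₂ (_ , χε≡true , _) = ⊥-elim (false≢true (trans (sym (cong weight ℓ-ε)) χε≡true))
      inv-basic : ∀ x y → col x ≡ col y → col (x ⁻¹) ≡ col (y ⁻¹)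
      inv-basic x y c with classes c
      ... | inj₁ refl              = refl
      ... | inj₂ (_ , χy , ℓx≡ℓy) = same-class (inj₂ (coset-of-ℓ (x ⁻¹) (y ⁻¹) (trans (cong weight (ℓ-⁻¹ y)) χy)
                                                                 (trans (ℓ-⁻¹ x) (trans ℓx≡ℓy (sym (ℓ-⁻¹ y))))))
      mult : ∀ x₀ y₀ z z′ → col z ≡ col z′ → Pairs k col x₀ y₀ z ↔ Pairs k col x₀ y₀ z′
      mult x₀ y₀ z z′ c with classes c
      ... | inj₁ refl  = ↔-refl
      ... | inj₂ coset = coset-bijection coset

    S-union : SUnion k col
    S-union x y c Sx with classes c
    ... | inj₁ refl              = Sx
    ... | inj₂ (χx , _ , ℓx≡ℓy) = ℓ≡C⇒S (trans (sym ℓx≡ℓy) (S∖U-coset Sx χx))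

  representative : Bits → 𝔾
  representative (p , q , r) = ⟨ (if p then 1 else 0) mod k , q , false , r ⟩

  ℓ-representative : ∀ v → ℓ (representative v) ≡ v
  ℓ-representative (true  , q , r) = cong₂ _,_ (cong odd (trans (toℕ-mod 1) (m<n⇒m%n≡m 1<k))) (cong (_, r) (xor-identityʳ q))
  ℓ-representative (false , q , r) = cong₂ _,_ (cong odd expA-ε) (cong (_, r) (xor-identityʳ q))

  canonical′ : Bool → 𝔾 → 𝔾
  canonical′ true  x = representative (ℓ x)
  canonical′ false x = x

  canonical : 𝔾 → 𝔾
  canonical x = canonical′ (χ x) x

  canonical-at : ∀ {x j} → χ x ≡ j → canonical x ≡ canonical′ j x
  canonical-at {x} = cong (λ j → canonical′ j x)

  ℓ-canonical : ∀ x → ℓ (canonical x) ≡ ℓ x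
  ℓ-canonical x = by-case (χ x)
    where
    by-case : ∀ j → ℓ (canonical′ j x) ≡ ℓ x
    by-case true  = ℓ-representative (ℓ x)
    by-case false = refl

  χ-canonical : ∀ x → χ (canonical x) ≡ χ x
  χ-canonical x = cong weight (ℓ-canonical x)

  canonical-fibres : ∀ x y → (canonical x ≡ canonical y) ⇔ (x ≡ y ⊎ Coset x y)
  canonical-fibres x y = mk⇔ (to (χ x) refl) from
    where
    χy≡χx : canonical x ≡ canonical y → χ y ≡ χ x
    χy≡χx p = trans (sym (χ-canonical y)) (trans (cong χ (sym p)) (χ-canonical x))
    to : ∀ j → χ x ≡ j → canonical x ≡ canonical y → x ≡ y ⊎ Coset x y
    to false χx p = inj₁ (begin
      x             ≡⟨ canonical-at {x} {false} χx ⟨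
      canonical x   ≡⟨ p ⟩
      canonical y   ≡⟨ canonical-at {y} {false} (trans (χy≡χx p) χx) ⟩
      y             ∎)
      where open ≡-Reasoning
    to true χx p = inj₂ (coset-of-ℓ x y (trans (χy≡χx p) χx)
                          (trans (sym (ℓ-canonical x)) (trans (cong ℓ p) (ℓ-canonical y))))
    from : x ≡ y ⊎ Coset x y → canonical x ≡ canonical y
    from (inj₁ refl)            = refl
    from (inj₂ (χx , χy , ℓx≡ℓy)) =
      trans (canonical-at χx) (trans (cong representative ℓx≡ℓy) (sym (canonical-at χy)))

  wreath-colouring : 𝔾 → ℕ
  wreath-colouring x = code (canonical x)

  wreath-colouring-fibres : ∀ x y → (wreath-colouring x ≡ wreath-colouring y) ⇔ (x ≡ y ⊎ Coset x y)
  wreath-colouring-fibres x y = ⇔.trans (mk⇔ code-injective (cong code)) (canonical-fibres x y)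

module EvenSchurRing (k : ℕ) .{{_ : NonZero k}} (k≥3 : 3 ≤ k) (r : ℕ) (k≡r*2 : k ≡ r * 2)
                     (col : G k → ℕ) (isSRing : IsSRing k col) (S-union : SUnion k col) where
  open SchurRing k k≥3 col isSRing S-union
  open EvenCase k k≥3 r k≡r*2

  U-singleton : ∀ {x} → U k x → Singleton x
  U-singleton = singleton-Gen generators
    where
    a²-singleton : Singleton (a k ∙ a k)
    a²-singleton = singleton-≡ (sym (aPow-+ 1 1)) aPow2-singleton
    da-singleton : Singleton (d k ∙ a k)
    da-singleton = singleton-≡ (solve₀ ((`d `∙ `b) `∙ (`c `∙ `b) `∙ (`c `∙ `a)) (`d `∙ `a) refl)
                               (singleton-∙ (singleton-∙ db-singleton cb-singleton) ca-singleton)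
    generators : ∀ {x} → L k x ⊎ x ≡ c k ∙ a k ⊎ x ≡ d k ∙ a k → Singleton x
    generators (inj₁ (y , z , A₁y , ⟨cb⟩z , refl)) =
      singleton-∙ (singleton-Gen (λ { refl → a²-singleton }) A₁y) (singleton-Gen (λ { refl → cb-singleton }) ⟨cb⟩z)
    generators (inj₂ (inj₁ refl)) = ca-singleton
    generators (inj₂ (inj₂ refl)) = da-singleton

  -- Outside U write x = u·c with u ∈ U; a pair in the classes of (u, c) with product y is (u, s) with s ∈ S ∖ U.
  refines-cosets : ∀ x y → col x ≡ col y → x ≡ y ⊎ Coset x y
  refines-cosets x y cxy with χ x in χx
  ... | false = inj₁ (U-singleton (χ≡false⇒U χx) y cxy)
  ... | true  with transfer (//-rightDividesˡ (c k) x) cxy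
  ...   | (u′ , s) , cu , cs , u′s≡y = inj₂ (refl , trans (cong weight (sym ℓx≡ℓy)) χx , ℓx≡ℓy)
    where
    u = x ∙ c k ⁻¹
    χc : χ (c k) ≡ true
    χc = cong weight (ℓ-word `c)
    χu : χ u ≡ false
    χu = trans (χ-∙ x (c k ⁻¹)) (cong₂ _xor_ χx (trans (cong weight (ℓ-⁻¹ (c k))) χc))
    u≡u′ : u ≡ u′
    u≡u′ = U-singleton (χ≡false⇒U χu) u′ (sym cu)
    χs : χ s ≡ true
    χs with χ s in χs≡
    ... | true  = refl
    ... | false = ⊥-elim (false≢true (trans (sym χs≡) (trans (cong χ (U-singleton {s} (χ≡false⇒U χs≡) (c k) cs)) χc)))
    ℓx≡ℓy : ℓ x ≡ ℓ y
    ℓx≡ℓy = begin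
      ℓ x               ≡⟨ cong ℓ (//-rightDividesˡ (c k) x) ⟨
      ℓ (u ∙ c k)       ≡⟨ ℓ-∙ u (c k) ⟩
      ℓ u ⊕ ℓ (c k)     ≡⟨ cong (ℓ u ⊕_) (trans (ℓ-word `c) (sym (S∖U-coset (S-union (c k) s (sym cs) c∈S) χs))) ⟩
      ℓ u ⊕ ℓ s         ≡⟨ ℓ-∙ u s ⟨
      ℓ (u ∙ s)         ≡⟨ cong ℓ (trans (cong (_∙ s) u≡u′) u′s≡y) ⟩
      ℓ y               ∎
      where open ≡-Reasoning

WL-characterisation : (k : ℕ) .{{_ : NonZero k}} (R : G k → G k → Set) →
  (∀ col → IsSRing k col → SUnion k col → ∀ x y → col x ≡ col y → R x y) →
  (∀ col → (∀ x y → (col x ≡ col y) ⇔ R x y) → IsSRing k col × SUnion k col) →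
  (Σ (G k → ℕ) λ col₀ → ∀ x y → (col₀ x ≡ col₀ y) ⇔ R x y) →
  ∀ col → IsWL k col ⇔ (∀ x y → (col x ≡ col y) ⇔ R x y)
WL-characterisation k R refines realises (col₀ , fibres₀) col = mk⇔ to from
  where
  to : IsWL k col → ∀ x y → (col x ≡ col y) ⇔ R x y
  to wl x y = mk⇔ (refines col (IsWL.sring wl) (IsWL.sunion wl) x y)
                  (λ Rxy → IsWL.minimal wl col₀ (proj₁ (realises col₀ fibres₀)) (proj₂ (realises col₀ fibres₀)) x y
                                        (Equivalence.from (fibres₀ x y) Rxy))
  from : (∀ x y → (col x ≡ col y) ⇔ R x y) → IsWL k col
  from fibres = record
    { sring   = proj₁ (realises col fibres)
    ; sunion  = proj₂ (realises col fibres)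
    ; minimal = λ col′ sr su x y c → Equivalence.from (fibres x y) (refines col′ sr su x y c)
    }

discrete-isSRing : (k : ℕ) .{{_ : NonZero k}} (col : G k → ℕ) → (∀ x y → (col x ≡ col y) ⇔ x ≡ y) →
                   IsSRing k col × SUnion k col
discrete-isSRing k col fibres = record
  { e-basic   = λ x c → to (fibres x (e k)) c
  ; inv-basic = λ x y c → cong (λ t → col (inv k t)) (to (fibres x y) c)
  ; mult      = λ x₀ y₀ z z′ c →
                  subst (λ t → Pairs k col x₀ y₀ z ↔ Pairs k col x₀ y₀ t) (to (fibres z z′) c) ↔-refl
  } , λ x y c Sx → subst (S k) (to (fibres x y) c) Sx
  where open Equivalence

lemma3p2 : (k : ℕ) .{{_ : NonZero k}} → 3 ≤ k →
    (¬ (2 ∣ k) → ∀ (col : G k → ℕ) →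
       IsWL k col ⇔ (∀ x y → (col x ≡ col y) ⇔ (x ≡ y)))
    × (2 ∣ k → ∀ (col : G k → ℕ) →
       IsWL k col ⇔ (∀ x y → (col x ≡ col y) ⇔ WreathRel k x y))
lemma3p2 k k≥3 = odd-case , even-case
  where
  odd-case : ¬ (2 ∣ k) → ∀ col → IsWL k col ⇔ (∀ x y → (col x ≡ col y) ⇔ (x ≡ y))
  odd-case k-odd = WL-characterisation k _≡_
    (λ col sr su → OddCase.discrete k k≥3 k-odd col sr su)
    (discrete-isSRing k)
    (GroupLaws.code k , λ x y → mk⇔ (GroupLaws.code-injective k) (cong (GroupLaws.code k)))
  even-case : 2 ∣ k → ∀ col → IsWL k col ⇔ (∀ x y → (col x ≡ col y) ⇔ WreathRel k x y)
  even-case (divides r k≡r*2) = WL-characterisation k (WreathRel k)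
    (λ col sr su x y c → Equivalence.from WreathRel⇔ (EvenSchurRing.refines-cosets k k≥3 r k≡r*2 col sr su x y c))
    (λ col fibres → let open CosetPartition col (λ x y → ⇔.trans (fibres x y) WreathRel⇔) in isSRing , S-union)
    (wreath-colouring , λ x y → ⇔.trans (wreath-colouring-fibres x y) (⇔.sym WreathRel⇔))
    where open EvenCase k k≥3 r k≡r*2
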